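{- Let $P=(X,\prec)$ be a finite poset with $|X|=n$, let $x,y,z\in X$ be distinct, and let $k,\ell\ge1$ be integers. Let $\mathrm{F}(a,b)$ denote the number of linear extensions $L$ of $P$ with $L(y)-L(x)=a$ and $L(z)-L(y)=b$. If $\mathrm{F}(k,\ell)\,\mathrm{F}(k+1,\ell+1)>0$, then $$\mathrm{F}(k+1,\ell)\,\mathrm{F}(k,\ell+1)\ \le\ 2k\ell\,(\min\{k,\ell\}+1)\,n\cdot \mathrm{F}(k,\ell)\,\mathrm{F}(k+1,\ell+1).$$
   Context: A linear extension of a finite poset $P=(X,\prec)$ with $|X|=n$ is a bijection $L:X\to\{1,\dots,n\}$ with $L(u)<L(v)$ whenever $u\prec v$. -}

module Defs where

open import Data.Nat using (ℕ; zero; suc; _+_; _≟_)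
open import Data.Fin using (Fin; toℕ)
import Data.Fin.Properties as FinP
open import Data.List using (List; []; _∷_; concatMap; length; filter; allFin)
open import Data.Product using (_×_; _,_; ∃)
open import Relation.Nullary using (Dec; yes; no; ¬_)
open import Relation.Nullary.Decidable using (_×-dec_; _→-dec_)
open import Relation.Binary using (Rel; Decidable)
open import Relation.Binary.PropositionalEquality using (_≡_)
open import Level using (0ℓ)

record FinPoset (n : ℕ) : Set₁ where
  field
    _≺_     : Rel (Fin n) 0ℓ
    ≺-dec   : Decidable _≺_
    irrefl  : ∀ {u} → ¬ (u ≺ u)
    trans   : ∀ {u v w} → u ≺ v → v ≺ w → u ≺ w

-- Positions are Fin n = {0,…,n-1} rather than {1,…,n}; this shift does
-- not affect the differences L(y) - L(x) used below.
IsBijection : ∀ {n} → (Fin n → Fin n) → Set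
IsBijection {n} L = (∀ u v → L u ≡ L v → u ≡ v) × (∀ j → ∃ λ i → L i ≡ j)

IsLinearExtension : ∀ {n} → FinPoset n → (Fin n → Fin n) → Set
IsLinearExtension {n} P L =
  IsBijection L × (∀ u v → u ≺ v → toℕ (L u) Data.Nat.< toℕ (L v))
  where open FinPoset P

allFuns : ∀ n m → List (Fin n → Fin m)
allFuns zero    m = (λ ()) ∷ []
allFuns (suc n) m =
  concatMap (λ i → Data.List.map (λ f → λ { Fin.zero → i ; (Fin.suc k) → f k })
                                   (allFuns n m))
            (allFin m)

isBij? : ∀ {n} (L : Fin n → Fin n) → Dec (IsBijection L)
isBij? L =
  FinP.all? (λ u → FinP.all? (λ v → (FinP._≟_ (L u) (L v)) →-dec (FinP._≟_ u v)))
  ×-dec FinP.all? (λ j → FinP.any? (λ i → FinP._≟_ (L i) j))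

isLE? : ∀ {n} (P : FinPoset n) (L : Fin n → Fin n) → Dec (IsLinearExtension P L)
isLE? P L = isBij? L ×-dec
  FinP.all? (λ u → FinP.all? (λ v → ≺-dec u v →-dec Data.Nat.Properties._<?_ (toℕ (L u)) (toℕ (L v))))
  where open FinPoset P
        import Data.Nat.Properties

FCond : ∀ {n} → FinPoset n → Fin n → Fin n → Fin n → ℕ → ℕ → (Fin n → Fin n) → Set
FCond P x y z a b L =
  IsLinearExtension P L × (toℕ (L y) ≡ toℕ (L x) + a) × (toℕ (L z) ≡ toℕ (L y) + b)

FCond? : ∀ {n} (P : FinPoset n) x y z a b (L : Fin n → Fin n) → Dec (FCond P x y z a b L)
FCond? P x y z a b L =
  isLE? P L ×-dec (toℕ (L y) ≟ toℕ (L x) + a) ×-dec (toℕ (L z) ≟ toℕ (L y) + b)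

F : ∀ {n} → FinPoset n → Fin n → Fin n → Fin n → ℕ → ℕ → ℕ
F {n} P x y z a b = length (filter (FCond? P x y z a b) (allFuns n n))

{-# OPTIONS --safe #-}
module Submission where

-- Write A = F(k,ℓ), B = F(k+1,ℓ+1), C = F(k+1,ℓ), D = F(k,ℓ+1). Both factors of the bound come from
-- encodings. A linear extension counted by C becomes one counted by A by moving a single element
-- from between x and y down onto x or up onto z (after first moving some element up onto y when no
-- such move is possible); the moves are undone from a tag with at most 2kℓ values, so C ≤ 2kℓ·A.
-- Likewise D ≤ n(ℓ+1)·B by moving an element into the gap between x and y, either from below x, or
-- from beyond z after letting some element between y and z move down onto y. If no admissible move
-- exists, chains of blocking relations ≺ force too many elements into a window of a fixed linear
-- extension counted by A (resp. B), which is impossible by pigeonhole. Reversing the order exchanges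
-- the roles of k and ℓ, and multiplying the appropriate pair of bounds yields the factor min(k,ℓ)+1.

open import Defs
open import Data.Empty using (⊥; ⊥-elim)
open import Data.Fin using (Fin; toℕ; fromℕ<) renaming (zero to fzero; suc to fsuc)
open import Data.Fin.Properties using (toℕ-fromℕ<; toℕ-injective; toℕ<n)
import Data.Fin.Properties as FinP
open import Data.List using (List; []; _∷_; _++_; map; concatMap; length; filter; allFin; applyUpTo; upTo; cartesianProduct)
open import Data.List.Properties using (length-++; length-map; length-applyUpTo; length-upTo; length-removeAt′)
open import Data.List.Membership.Propositional using (_∈_; lose)
open import Data.List.Membership.Propositional.Properties using (∈-allFin; ∈-cartesianProduct⁺)
open import Data.List.Relation.Unary.Any as Any using (Any; here; there)
import Data.List.Relation.Unary.Any.Properties as Anyₚ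
open import Data.List.Relation.Unary.All as All using (All; []; _∷_)
import Data.List.Relation.Unary.All.Properties as Allₚ
open import Data.List.Relation.Unary.AllPairs as AllPairs using (AllPairs; []; _∷_)
import Data.List.Relation.Unary.AllPairs.Properties as AllPairsₚ
open import Data.List.Relation.Unary.Unique.Propositional using (Unique)
import Data.List.Relation.Unary.Unique.Propositional.Properties as Uniqueₚ
open import Data.Nat
open import Data.Nat.Properties
open import Data.Nat.Solver using (module +-*-Solver)
open import Data.Product using (_×_; _,_; proj₁; proj₂; ∃)
open import Data.Sum using (_⊎_; inj₁; inj₂)
open import Data.Unit using (tt)
open import Function using (_∘_)
open import Level using (0ℓ)
open import Relation.Binary using (tri<; tri≈; tri>; Rel; Symmetric; Transitive)
open import Relation.Binary.PropositionalEquality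
open import Relation.Nullary using (¬_; yes; no; Dec)
open import Relation.Nullary.Decidable using (_×-dec_; _→-dec_; _⊎-dec_; ¬?)
open import Relation.Unary using (Pred) renaming (Decidable to Decidable₁)

abstract
  moveUp : ℕ → ℕ → ℕ → ℕ
  moveUp a b p with <-cmp p a
  ... | tri< _ _ _ = p
  ... | tri≈ _ _ _ = b
  ... | tri> _ _ _ with p ≤? b
  ...   | yes _ = pred p
  ...   | no _ = p

  moveDown : ℕ → ℕ → ℕ → ℕ
  moveDown a b p with <-cmp p a
  ... | tri< _ _ _ with p <? b
  ...   | yes _ = p
  ...   | no _ = suc p
  moveDown a b p | tri≈ _ _ _ = b
  moveDown a b p | tri> _ _ _ = p

  moveUp-below : ∀ {a b p} → p < a → moveUp a b p ≡ p
  moveUp-below {a} {b} {p} h with <-cmp p a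
  ... | tri< _ _ _ = refl
  ... | tri≈ ¬p<a _ _ = ⊥-elim (¬p<a h)
  ... | tri> ¬p<a _ _ = ⊥-elim (¬p<a h)

  moveUp-source : ∀ {a b p} → p ≡ a → moveUp a b p ≡ b
  moveUp-source {a} {b} {p} h with <-cmp p a
  ... | tri< _ p≢a _ = ⊥-elim (p≢a h)
  ... | tri≈ _ _ _ = refl
  ... | tri> _ p≢a _ = ⊥-elim (p≢a h)

  moveUp-between : ∀ {a b p} → a < p → p ≤ b → moveUp a b p ≡ pred p
  moveUp-between {a} {b} {p} a<p p≤b with <-cmp p a
  ... | tri< _ _ ¬a<p = ⊥-elim (¬a<p a<p)
  ... | tri≈ _ _ ¬a<p = ⊥-elim (¬a<p a<p)
  ... | tri> _ _ _ with p ≤? b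
  ...   | yes _ = refl
  ...   | no p≰b = ⊥-elim (p≰b p≤b)

  moveUp-above : ∀ {a b p} → a ≤ b → b < p → moveUp a b p ≡ p
  moveUp-above {a} {b} {p} a≤b b<p with <-cmp p a
  ... | tri< p<a _ _ = ⊥-elim (<-asym p<a (≤-<-trans a≤b b<p))
  ... | tri≈ _ refl _ = ⊥-elim (<-irrefl refl (≤-<-trans a≤b b<p))
  ... | tri> _ _ _ with p ≤? b
  ...   | yes p≤b = ⊥-elim (<-irrefl refl (<-≤-trans b<p p≤b))
  ...   | no _ = refl

  moveDown-below : ∀ {a b p} → b ≤ a → p < b → moveDown a b p ≡ p
  moveDown-below {a} {b} {p} b≤a p<b with <-cmp p a
  ... | tri< _ _ _ with p <? b
  ...   | yes _ = refl
  ...   | no p≮b = ⊥-elim (p≮b p<b)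
  moveDown-below {a} {b} {p} b≤a p<b | tri≈ _ refl _ = ⊥-elim (<-irrefl refl (<-≤-trans p<b b≤a))
  moveDown-below {a} {b} {p} b≤a p<b | tri> _ _ a<p = ⊥-elim (<-asym a<p (<-≤-trans p<b b≤a))

  moveDown-between : ∀ {a b p} → b ≤ p → p < a → moveDown a b p ≡ suc p
  moveDown-between {a} {b} {p} b≤p p<a with <-cmp p a
  ... | tri< _ _ _ with p <? b
  ...   | yes p<b = ⊥-elim (<-irrefl refl (<-≤-trans p<b b≤p))
  ...   | no _ = refl
  moveDown-between {a} {b} {p} b≤p p<a | tri≈ ¬p<a _ _ = ⊥-elim (¬p<a p<a)
  moveDown-between {a} {b} {p} b≤p p<a | tri> ¬p<a _ _ = ⊥-elim (¬p<a p<a)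

  moveDown-source : ∀ {a b p} → p ≡ a → moveDown a b p ≡ b
  moveDown-source {a} {b} {p} h with <-cmp p a
  ... | tri< _ p≢a _ = ⊥-elim (p≢a h)
  ... | tri≈ _ _ _ = refl
  ... | tri> _ p≢a _ = ⊥-elim (p≢a h)

  moveDown-above : ∀ {a b p} → a < p → moveDown a b p ≡ p
  moveDown-above {a} {b} {p} a<p with <-cmp p a
  ... | tri< _ _ ¬a<p = ⊥-elim (¬a<p a<p)
  ... | tri≈ _ _ ¬a<p = ⊥-elim (¬a<p a<p)
  ... | tri> _ _ _ = refl

data UpRegion (a b p : ℕ) : Set where
  before  : p < a → UpRegion a b p
  source  : p ≡ a → UpRegion a b p
  between : a < p → p ≤ b → UpRegion a b p
  beyond  : b < p → UpRegion a b p

upRegion : ∀ a b p → UpRegion a b p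
upRegion a b p with <-cmp p a | p ≤? b
... | tri< p<a _ _ | _     = before p<a
... | tri≈ _ p≡a _ | _     = source p≡a
... | tri> _ _ a<p | yes p≤b = between a<p p≤b
... | tri> _ _ _   | no p≰b  = beyond (≰⇒> p≰b)

data DownRegion (a b p : ℕ) : Set where
  below   : p < b → DownRegion a b p
  between : b ≤ p → p < a → DownRegion a b p
  source  : p ≡ a → DownRegion a b p
  above   : a < p → DownRegion a b p

downRegion : ∀ a b p → DownRegion a b p
downRegion a b p with <-cmp p a | p <? b
... | tri< _ _ _   | yes p<b = below p<b
... | tri< p<a _ _ | no p≮b  = between (≮⇒≥ p≮b) p<a
... | tri≈ _ p≡a _ | _       = source p≡a
... | tri> _ _ a<p | _       = above a<p

m<n⇒suc[pred[n]]≡n : ∀ {m n} → m < n → suc (pred n) ≡ n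
m<n⇒suc[pred[n]]≡n (s≤s _) = refl

moveUp-< : ∀ {a b p n} → a ≤ b → b < n → p < n → moveUp a b p < n
moveUp-< {a} {b} {p} a≤b b<n p<n with upRegion a b p
... | before p<a        = subst (_< _) (sym (moveUp-below p<a)) p<n
... | source p≡a        = subst (_< _) (sym (moveUp-source p≡a)) b<n
... | between a<p p≤b   = subst (_< _) (sym (moveUp-between a<p p≤b)) (≤-<-trans pred[n]≤n p<n)
... | beyond b<p        = subst (_< _) (sym (moveUp-above a≤b b<p)) p<n

moveDown-< : ∀ {a b p n} → b ≤ a → a < n → p < n → moveDown a b p < n
moveDown-< {a} {b} {p} b≤a a<n p<n with downRegion a b p
... | below p<b         = subst (_< _) (sym (moveDown-below b≤a p<b)) p<n
... | between b≤p p<a   = subst (_< _) (sym (moveDown-between b≤p p<a)) (<-≤-trans (s≤s p<a) a<n)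
... | source p≡a        = subst (_< _) (sym (moveDown-source p≡a)) (≤-<-trans b≤a a<n)
... | above a<p         = subst (_< _) (sym (moveDown-above a<p)) p<n

moveDown-moveUp : ∀ {a b p} → a ≤ b → moveDown b a (moveUp a b p) ≡ p
moveDown-moveUp {a} {b} {p} a≤b with upRegion a b p
... | before p<a =
  trans (cong (moveDown b a) (moveUp-below p<a)) (moveDown-below a≤b p<a)
... | source refl =
  trans (cong (moveDown b a) (moveUp-source refl)) (moveDown-source refl)
... | between a<p p≤b =
  trans (cong (moveDown b a) (moveUp-between a<p p≤b))
        (trans (moveDown-between (<⇒≤pred a<p) (subst (_≤ b) (sym (m<n⇒suc[pred[n]]≡n a<p)) p≤b)) (m<n⇒suc[pred[n]]≡n a<p))
... | beyond b<p =
  trans (cong (moveDown b a) (moveUp-above a≤b b<p)) (moveDown-above b<p)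

moveUp-moveDown : ∀ {a b p} → a ≤ b → moveUp a b (moveDown b a p) ≡ p
moveUp-moveDown {a} {b} {p} a≤b with downRegion b a p
... | below p<a =
  trans (cong (moveUp a b) (moveDown-below a≤b p<a)) (moveUp-below p<a)
... | between a≤p p<b =
  trans (cong (moveUp a b) (moveDown-between a≤p p<b)) (moveUp-between (s≤s a≤p) p<b)
... | source refl =
  trans (cong (moveUp a b) (moveDown-source refl)) (moveUp-source refl)
... | above b<p =
  trans (cong (moveUp a b) (moveDown-above b<p)) (moveUp-above a≤b b<p)

moveUp-mono-< : ∀ {a b p q} → a ≤ b → p < q → (p ≡ a → b < q) → moveUp a b p < moveUp a b q
moveUp-mono-< {a} {b} {p} {q} a≤b p<q source⇒beyond with upRegion a b p | upRegion a b q
... | before p<a | before q<a =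
  subst₂ _<_ (sym (moveUp-below p<a)) (sym (moveUp-below q<a)) p<q
... | before p<a | source q≡a =
  subst₂ _<_ (sym (moveUp-below p<a)) (sym (moveUp-source q≡a)) (<-≤-trans p<a a≤b)
... | before p<a | between a<q q≤b =
  subst₂ _<_ (sym (moveUp-below p<a)) (sym (moveUp-between a<q q≤b)) (<-≤-trans p<a (<⇒≤pred a<q))
... | before p<a | beyond b<q =
  subst₂ _<_ (sym (moveUp-below p<a)) (sym (moveUp-above a≤b b<q)) p<q
... | source p≡a | _ =
  subst₂ _<_ (sym (moveUp-source p≡a)) (sym (moveUp-above a≤b b<q)) b<q
  where b<q = source⇒beyond p≡a
... | between a<p _ | before q<a = ⊥-elim (<-asym q<a (<-trans a<p p<q))
... | between a<p _ | source refl = ⊥-elim (<-asym a<p p<q)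
... | between a<p p≤b | between a<q q≤b =
  subst₂ _<_ (sym (moveUp-between a<p p≤b)) (sym (moveUp-between a<q q≤b))
    (pred-mono-< {{>-nonZero (≤-<-trans z≤n a<p)}} p<q)
... | between a<p p≤b | beyond b<q =
  subst₂ _<_ (sym (moveUp-between a<p p≤b)) (sym (moveUp-above a≤b b<q)) (≤-<-trans pred[n]≤n p<q)
... | beyond b<p | before q<a = ⊥-elim (<-asym q<a (≤-<-trans a≤b (<-trans b<p p<q)))
... | beyond b<p | source refl = ⊥-elim (<-asym p<q (≤-<-trans a≤b b<p))
... | beyond b<p | between _ q≤b = ⊥-elim (<-asym b<p (<-≤-trans p<q q≤b))
... | beyond b<p | beyond b<q =
  subst₂ _<_ (sym (moveUp-above a≤b b<p)) (sym (moveUp-above a≤b b<q)) p<q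

moveDown-mono-< : ∀ {a b p q} → b ≤ a → p < q → (q ≡ a → p < b) → moveDown a b p < moveDown a b q
moveDown-mono-< {a} {b} {p} {q} b≤a p<q source⇒below with downRegion a b p | downRegion a b q
... | below p<b | below q<b =
  subst₂ _<_ (sym (moveDown-below b≤a p<b)) (sym (moveDown-below b≤a q<b)) p<q
... | below p<b | between b≤q q<a =
  subst₂ _<_ (sym (moveDown-below b≤a p<b)) (sym (moveDown-between b≤q q<a)) (m<n⇒m<1+n p<q)
... | below p<b | source q≡a =
  subst₂ _<_ (sym (moveDown-below b≤a p<b)) (sym (moveDown-source q≡a)) p<b
... | below p<b | above a<q =
  subst₂ _<_ (sym (moveDown-below b≤a p<b)) (sym (moveDown-above a<q)) p<q
... | between b≤p _ | below q<b = ⊥-elim (<-asym q<b (≤-<-trans b≤p p<q))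
... | between b≤p p<a | between b≤q q<a =
  subst₂ _<_ (sym (moveDown-between b≤p p<a)) (sym (moveDown-between b≤q q<a)) (s≤s p<q)
... | between b≤p _ | source q≡a = ⊥-elim (<⇒≱ (source⇒below q≡a) b≤p)
... | between b≤p p<a | above a<q =
  subst₂ _<_ (sym (moveDown-between b≤p p<a)) (sym (moveDown-above a<q)) (≤-<-trans p<a a<q)
... | source refl | below q<b = ⊥-elim (<-asym q<b (≤-<-trans b≤a p<q))
... | source refl | between _ q<a = ⊥-elim (<-asym p<q q<a)
... | source refl | source refl = ⊥-elim (<-irrefl refl p<q)
... | source p≡a | above a<q =
  subst₂ _<_ (sym (moveDown-source p≡a)) (sym (moveDown-above a<q)) (≤-<-trans b≤a a<q)
... | above a<p | below q<b = ⊥-elim (<-asym q<b (≤-<-trans b≤a (<-trans a<p p<q)))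
... | above a<p | between _ q<a = ⊥-elim (<-asym q<a (<-trans a<p p<q))
... | above a<p | source refl = ⊥-elim (<-asym a<p p<q)
... | above a<p | above a<q =
  subst₂ _<_ (sym (moveDown-above a<p)) (sym (moveDown-above a<q)) p<q

moveUp-≤ : ∀ {a b p c} → a ≤ b → p ≤ c → b ≤ c → moveUp a b p ≤ c
moveUp-≤ {a} {b} {p} a≤b p≤c b≤c with upRegion a b p
... | before p<a      = subst (_≤ _) (sym (moveUp-below p<a)) p≤c
... | source p≡a      = subst (_≤ _) (sym (moveUp-source p≡a)) b≤c
... | between a<p p≤b = subst (_≤ _) (sym (moveUp-between a<p p≤b)) (≤-trans pred[n]≤n p≤c)
... | beyond b<p      = subst (_≤ _) (sym (moveUp-above a≤b b<p)) p≤c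

-- Counting by decoding

module _ {A B : Set} {_≈_ : Rel A 0ℓ} (R : A → B → Set) (R-injective : ∀ {a a' b} → R a b → R a' b → a ≈ a') where

  private
    Any-─ : ∀ {a a'} (ys : List B) (a∈ys : Any (R a) ys) → Any (R a') ys → ¬ a ≈ a' →
            Any (R a') (ys Any.─ a∈ys)
    Any-─ (_ ∷ _)  (here Ray)   (here Ra'y)   a≉a' = ⊥-elim (a≉a' (R-injective Ray Ra'y))
    Any-─ (_ ∷ _)  (here _)     (there a'∈ys) _    = a'∈ys
    Any-─ (_ ∷ _)  (there _)    (here Ra'y)   _    = here Ra'y
    Any-─ (_ ∷ ys) (there a∈ys) (there a'∈ys) a≉a' = there (Any-─ ys a∈ys a'∈ys a≉a')

  pigeonhole : ∀ xs ys → AllPairs (λ a a' → ¬ a ≈ a') xs → All (λ a → Any (R a) ys) xs →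
               length xs ≤ length ys
  pigeonhole []       ys _           _              = z≤n
  pigeonhole (x ∷ xs) ys (x≉xs ∷ uxs) (x∈ys ∷ xs∈ys) =
    subst (suc (length xs) ≤_) (sym (length-removeAt′ ys (Any.index x∈ys)))
      (s≤s (pigeonhole xs (ys Any.─ x∈ys) uxs (All.zipWith (λ (a∈ys , x≉a) → Any-─ ys x∈ys a∈ys x≉a) (xs∈ys , x≉xs))))

≗-sym : ∀ {A B : Set} → Symmetric (_≗_ {A = A} {B = B})
≗-sym f≗g x = sym (f≗g x)

≗-trans : ∀ {A B : Set} → Transitive (_≗_ {A = A} {B = B})
≗-trans f≗g g≗h x = trans (f≗g x) (g≗h x)

_≉_ : ∀ {n m} → (Fin n → Fin m) → (Fin n → Fin m) → Set
f ≉ g = ¬ f ≗ g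

-- Abstracts over the consing function used by allFuns, a pattern lambda in Defs.
module Enumeration {n m : ℕ} (cons : Fin m → (Fin n → Fin m) → Fin (suc n) → Fin m)
    (cons-zero : ∀ i f → cons i f fzero ≡ i) (cons-suc : ∀ i f j → cons i f (fsuc j) ≡ f j)
    (L : List (Fin n → Fin m)) where

  extend : List (Fin m) → List (Fin (suc n) → Fin m)
  extend = concatMap (λ i → map (cons i) L)

  extend-complete : (∀ g → Any (g ≗_) L) → ∀ f → Any (f ≗_) (extend (allFin m))
  extend-complete L-complete f =
    Anyₚ.concatMap⁺ _ (lose (∈-allFin (f fzero))
      (Anyₚ.map⁺ (Any.map f≗cons (L-complete (f ∘ fsuc)))))
    where
    f≗cons : ∀ {g} → f ∘ fsuc ≗ g → f ≗ cons (f fzero) g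
    f≗cons eq fzero    = sym (cons-zero _ _)
    f≗cons eq (fsuc j) = trans (eq j) (sym (cons-suc _ _ j))

  extend-unique : AllPairs _≉_ L → ∀ is → Unique is → AllPairs _≉_ (extend is)
  extend-unique L-unique []       _            = []
  extend-unique L-unique (i ∷ is) (i∉is ∷ uis) =
    AllPairsₚ.++⁺ (AllPairsₚ.map⁺ (AllPairs.map cons-≉ L-unique))
                  (extend-unique L-unique is uis)
                  (Allₚ.map⁺ (All.universal (λ f → heads-differ f i∉is) L))
    where
    cons-≉ : ∀ {f g} → f ≉ g → cons i f ≉ cons i g
    cons-≉ f≉g eq = f≉g (λ j → trans (sym (cons-suc i _ j)) (trans (eq (fsuc j)) (cons-suc i _ j)))
    heads-differ : ∀ f {js} → All (i ≢_) js → All (cons i f ≉_) (extend js)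
    heads-differ f []           = []
    heads-differ f (i≢j ∷ i≢js) =
      Allₚ.++⁺ (Allₚ.map⁺ (All.universal (λ g eq → i≢j (trans (sym (cons-zero i f)) (trans (eq fzero) (cons-zero _ g)))) L))
               (heads-differ f i≢js)

allFuns-complete : ∀ n m (f : Fin n → Fin m) → Any (f ≗_) (allFuns n m)
allFuns-complete zero    m f = here (λ ())
allFuns-complete (suc n) m = Enumeration.extend-complete _ (λ _ _ → refl) (λ _ _ _ → refl) (allFuns n m) (allFuns-complete n m)

allFuns-unique : ∀ n m → AllPairs _≉_ (allFuns n m)
allFuns-unique zero    m = [] ∷ []
allFuns-unique (suc n) m =
  Enumeration.extend-unique _ (λ _ _ → refl) (λ _ _ _ → refl) (allFuns n m) (allFuns-unique n m) (allFin m) (Uniqueₚ.allFin⁺ m)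

length-concatMap-map : ∀ {A B C : Set} (g : A → B → C) (tags : List B) (zs : List A) →
  length (concatMap (λ a → map (g a) tags) zs) ≡ length tags * length zs
length-concatMap-map g tags [] = sym (*-zeroʳ (length tags))
length-concatMap-map g tags (a ∷ zs) = begin
  length (map (g a) tags ++ concatMap (λ a → map (g a) tags) zs)  ≡⟨ length-++ (map (g a) tags) ⟩
  length (map (g a) tags) + length (concatMap _ zs)               ≡⟨ cong₂ _+_ (length-map (g a) tags) (length-concatMap-map g tags zs) ⟩
  length tags + length tags * length zs                           ≡⟨ *-suc (length tags) (length zs) ⟨
  length tags * suc (length zs)                                   ∎
  where open ≡-Reasoning

count-by-decoding : ∀ {n m} {P Q : Pred (Fin n → Fin m) 0ℓ} (P? : Decidable₁ P) (Q? : Decidable₁ Q) →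
  (∀ {M M'} → M ≗ M' → Q M → Q M') →
  {T : Set} (tags : List T) (decode : T → (Fin n → Fin m) → Fin n → Fin m) →
  (∀ t {M M'} → M ≗ M' → decode t M ≗ decode t M') →
  (∀ L → P L → ∃ λ M → Q M × Any (λ t → L ≗ decode t M) tags) →
  length (filter P? (allFuns n m)) ≤ length tags * length (filter Q? (allFuns n m))
count-by-decoding {n} {m} {Q = Q} P? Q? Q-resp tags decode decode-resp encode =
  subst (length (filter P? (allFuns n m)) ≤_) (length-concatMap-map (λ M t → decode t M) tags (filter Q? (allFuns n m)))
    (pigeonhole _≗_ (λ f≗h g≗h → ≗-trans f≗h (≗-sym g≗h)) _ _ (AllPairsₚ.filter⁺ P? (allFuns-unique n m))
      (All.map (λ {L} pL → decoded (encode L pL)) (Allₚ.all-filter P? (allFuns n m))))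
  where
  in-filter : ∀ {M} → Q M → Any (M ≗_) (filter Q? (allFuns n m))
  in-filter {M} qM with Anyₚ.filter⁺ Q? (allFuns-complete n m M)
  ... | inj₁ M∈ = M∈
  ... | inj₂ ¬q = ⊥-elim (¬q (Q-resp (Anyₚ.lookup-result (allFuns-complete n m M)) qM))
  decoded : ∀ {L} → (∃ λ M → Q M × Any (λ t → L ≗ decode t M) tags) →
            Any (L ≗_) (concatMap (λ M → map (λ t → decode t M) tags) (filter Q? (allFuns n m)))
  decoded (M , qM , L≗) =
    Anyₚ.concatMap⁺ _ (Any.map (λ M≗M' → Anyₚ.map⁺ (Any.map (λ {t} L≗t → ≗-trans L≗t (decode-resp t M≗M')) L≗)) (in-filter qM))

∈-upTo : ∀ {i n} → i < n → i ∈ upTo n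
∈-upTo i<n = Anyₚ.applyUpTo⁺ _ refl i<n

length-cartesianProduct : ∀ {A B : Set} (xs : List A) (ys : List B) →
  length (cartesianProduct xs ys) ≡ length xs * length ys
length-cartesianProduct []       ys = refl
length-cartesianProduct (x ∷ xs) ys =
  trans (length-++ (map (x ,_) ys)) (cong₂ _+_ (length-map (x ,_) ys) (length-cartesianProduct xs ys))

filter-nonempty : ∀ {A : Set} {Q : Pred A 0ℓ} (Q? : Decidable₁ Q) xs → 0 < length (filter Q? xs) → ∃ Q
filter-nonempty Q? (a ∷ as) nonempty with Q? a
... | yes q = a , q
... | no _  = filter-nonempty Q? as nonempty

m+[n+1]≡suc[m]+n : ∀ m n → m + (n + 1) ≡ suc m + n
m+[n+1]≡suc[m]+n m n = trans (cong (m +_) (+-comm n 1)) (+-suc m n)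

m+n∸suc[m]≡n∸1 : ∀ m n → m + n ∸ suc m ≡ n ∸ 1
m+n∸suc[m]≡n∸1 zero    n = refl
m+n∸suc[m]≡n∸1 (suc m) n = m+n∸suc[m]≡n∸1 m n

suc[m]+[n∸1]≡m+n : ∀ m {n} → 1 ≤ n → suc m + (n ∸ 1) ≡ m + n
suc[m]+[n∸1]≡m+n m {suc n} _ = sym (+-suc m n)

m<n⇒n∸m≡suc[n∸suc[m]] : ∀ {m n} → m < n → n ∸ m ≡ suc (n ∸ suc m)
m<n⇒n∸m≡suc[n∸suc[m]] {zero}  {suc n} _         = refl
m<n⇒n∸m≡suc[n∸suc[m]] {suc m} {suc n} (s≤s m<n) = m<n⇒n∸m≡suc[n∸suc[m]] m<n

n≰n∸1 : ∀ {n} → 1 ≤ n → ¬ n ≤ n ∸ 1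
n≰n∸1 {suc n} _ = <-irrefl refl

n≤m∧m<n+o⇒m∸n<o : ∀ {m n o} → n ≤ m → m < n + o → m ∸ n < o
n≤m∧m<n+o⇒m∸n<o {m} {n} {o} n≤m m<n+o = subst (m ∸ n <_) (m+n∸m≡n n o) (∸-monoˡ-< m<n+o n≤m)

interval : ℕ → ℕ → List ℕ
interval s m = applyUpTo (s +_) m

length-interval : ∀ s m → length (interval s m) ≡ m
length-interval s m = length-applyUpTo (s +_) m

∈-interval⁺ : ∀ {s m q} → s ≤ q → q < s + m → q ∈ interval s m
∈-interval⁺ s≤q q<s+m = Anyₚ.applyUpTo⁺ _ (sym (m+[n∸m]≡n s≤q)) (n≤m∧m<n+o⇒m∸n<o s≤q q<s+m)

∈-interval⁻ : ∀ {s m q} → q ∈ interval s m → s ≤ q × q < s + m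
∈-interval⁻ {s} q∈ with Anyₚ.applyUpTo⁻ (s +_) q∈
... | i , i<m , refl = m≤m+n s i , +-monoʳ-< s i<m

interval-unique : ∀ s m → Unique (interval s m)
interval-unique s m = Uniqueₚ.applyUpTo⁺₁ (s +_) m (λ i<j _ eq → <⇒≢ i<j (+-cancelˡ-≡ s _ _ eq))

innerPositions : ℕ → ℕ → ℕ → List ℕ
innerPositions lo mid hi = interval (suc lo) (mid ∸ suc lo) ++ interval (suc mid) (hi ∸ suc mid)

length-innerPositions : ∀ lo mid hi → length (innerPositions lo mid hi) ≡ (mid ∸ suc lo) + (hi ∸ suc mid)
length-innerPositions lo mid hi =
  trans (length-++ (interval (suc lo) (mid ∸ suc lo))) (cong₂ _+_ (length-interval (suc lo) (mid ∸ suc lo)) (length-interval (suc mid) (hi ∸ suc mid)))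

∈-innerPositions⁺ : ∀ {lo mid hi q} → lo < q → q < hi → q ≢ mid → q ∈ innerPositions lo mid hi
∈-innerPositions⁺ {lo} {mid} {hi} {q} lo<q q<hi q≢mid with <-cmp q mid
... | tri< q<mid _ _ = Anyₚ.++⁺ˡ (∈-interval⁺ lo<q (subst (q <_) (sym (m+[n∸m]≡n (<-trans lo<q q<mid))) q<mid))
... | tri≈ _ q≡mid _ = ⊥-elim (q≢mid q≡mid)
... | tri> _ _ mid<q = Anyₚ.++⁺ʳ (interval (suc lo) _) (∈-interval⁺ mid<q (subst (q <_) (sym (m+[n∸m]≡n (<-trans mid<q q<hi))) q<hi))

∈-innerPositions⁻ : ∀ {lo mid hi q} → lo < mid → mid < hi → q ∈ innerPositions lo mid hi →
                   lo < q × q < hi × q ≢ mid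
∈-innerPositions⁻ {lo} {mid} {hi} {q} lo<mid mid<hi q∈ with Anyₚ.++⁻ (interval (suc lo) _) q∈
... | inj₁ q∈left with ∈-interval⁻ q∈left
...   | lo<q , q<mid′ = lo<q , <-trans q<mid mid<hi , <⇒≢ q<mid
  where q<mid = subst (q <_) (m+[n∸m]≡n lo<mid) q<mid′
∈-innerPositions⁻ {lo} {mid} {hi} {q} lo<mid mid<hi q∈ | inj₂ q∈right with ∈-interval⁻ q∈right
... | mid<q , q<hi = <-trans lo<mid mid<q , subst (q <_) (m+[n∸m]≡n mid<hi) q<hi , >⇒≢ mid<q

innerPositions-unique : ∀ lo mid hi → lo < mid → Unique (innerPositions lo mid hi)
innerPositions-unique lo mid hi lo<mid = Uniqueₚ.++⁺ (interval-unique _ _) (interval-unique _ _) disjoint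
  where
  disjoint : ∀ {q} → ¬ (q ∈ interval (suc lo) (mid ∸ suc lo) × q ∈ interval (suc mid) (hi ∸ suc mid))
  disjoint (q∈left , q∈right) =
    <-asym (subst (_ <_) (m+[n∸m]≡n lo<mid) (proj₂ (∈-interval⁻ q∈left))) (proj₁ (∈-interval⁻ q∈right))

data Relative (lo mid hi q : ℕ) : Set where
  at-lo  : q ≡ lo → Relative lo mid hi q
  at-mid : q ≡ mid → Relative lo mid hi q
  at-hi  : q ≡ hi → Relative lo mid hi q
  inner  : lo < q → q < hi → q ≢ mid → Relative lo mid hi q

relative : ∀ {lo mid hi q} → lo ≤ q → q ≤ hi → Relative lo mid hi q
relative {lo} {mid} {hi} {q} lo≤q q≤hi with q ≟ lo | q ≟ mid | q ≟ hi
... | yes q≡lo | _         | _        = at-lo q≡lo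
... | no _     | yes q≡mid | _        = at-mid q≡mid
... | no _     | no _      | yes q≡hi = at-hi q≡hi
... | no q≢lo  | no q≢mid  | no q≢hi  = inner (≤∧≢⇒< lo≤q (q≢lo ∘ sym)) (≤∧≢⇒< q≤hi q≢hi) q≢mid

-- Moves of elements in a linear extension

pos : ∀ {n} → (Fin n → Fin n) → Fin n → ℕ
pos L u = toℕ (L u)

pos-injective : ∀ {n} {L : Fin n → Fin n} → IsBijection L → ∀ {u v} → pos L u ≡ pos L v → u ≡ v
pos-injective (L-injective , _) eq = L-injective _ _ (toℕ-injective eq)

module _ {n : ℕ} where

  abstract
    fromℕ-or : ℕ → Fin n → Fin n
    fromℕ-or p d with p <? n
    ... | yes p<n = fromℕ< p<n
    ... | no _    = d

    toℕ-fromℕ-or : ∀ {p} (d : Fin n) → p < n → toℕ (fromℕ-or p d) ≡ p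
    toℕ-fromℕ-or {p} d p<n with p <? n
    ... | yes p<n′ = toℕ-fromℕ< p<n′
    ... | no p≮n   = ⊥-elim (p≮n p<n)

  -- The fallback L u in fromℕ-or is never used when φ is bounded.
  reindex : (ℕ → ℕ) → (Fin n → Fin n) → Fin n → Fin n
  reindex φ L u = fromℕ-or (φ (pos L u)) (L u)

  Bounded : (ℕ → ℕ) → Set
  Bounded φ = ∀ p → p < n → φ p < n

  pos-reindex : ∀ {φ} → Bounded φ → ∀ L u → pos (reindex φ L) u ≡ φ (pos L u)
  pos-reindex φ<n L u = toℕ-fromℕ-or (L u) (φ<n _ (toℕ<n (L u)))

  reindex-resp-≗ : ∀ φ {L L'} → L ≗ L' → reindex φ L ≗ reindex φ L'
  reindex-resp-≗ φ L≗L' u rewrite L≗L' u = refl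

  ≗-reindex : ∀ φ M L → (∀ u → φ (pos M u) ≡ pos L u) → L ≗ reindex φ M
  ≗-reindex φ M L φM≡L u =
    sym (toℕ-injective (trans (toℕ-fromℕ-or (M u) (subst (_< n) (sym (φM≡L u)) (toℕ<n (L u)))) (φM≡L u)))

  reindex-bijection : ∀ {φ ψ} {L : Fin n → Fin n} → Bounded φ → Bounded ψ →
    (∀ p → p < n → ψ (φ p) ≡ p) → (∀ q → q < n → φ (ψ q) ≡ q) →
    IsBijection L → IsBijection (reindex φ L)
  reindex-bijection {φ} {ψ} {L} φ<n ψ<n ψφ φψ (L-injective , L-surjective) = injective , surjective
    where
    injective : ∀ u v → reindex φ L u ≡ reindex φ L v → u ≡ v
    injective u v eq = L-injective u v (toℕ-injective (begin
      pos L u              ≡⟨ ψφ _ (toℕ<n (L u)) ⟨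
      ψ (φ (pos L u))      ≡⟨ cong ψ (pos-reindex φ<n L u) ⟨
      ψ (pos (reindex φ L) u) ≡⟨ cong (ψ ∘ toℕ) eq ⟩
      ψ (pos (reindex φ L) v) ≡⟨ cong ψ (pos-reindex φ<n L v) ⟩
      ψ (φ (pos L v))      ≡⟨ ψφ _ (toℕ<n (L v)) ⟩
      pos L v              ∎))
      where open ≡-Reasoning
    surjective : ∀ j → ∃ λ i → reindex φ L i ≡ j
    surjective j with L-surjective (fromℕ< (ψ<n (toℕ j) (toℕ<n j)))
    ... | i , Li≡ = i , toℕ-injective (trans (pos-reindex φ<n L i)
                          (trans (cong φ (trans (cong toℕ Li≡) (toℕ-fromℕ< _))) (φψ _ (toℕ<n j))))

  moveUp-bounded : ∀ {a b} → a ≤ b → b < n → Bounded (moveUp a b)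
  moveUp-bounded a≤b b<n p p<n = moveUp-< a≤b b<n p<n

  moveDown-bounded : ∀ {a b} → b ≤ a → a < n → Bounded (moveDown a b)
  moveDown-bounded b≤a a<n p p<n = moveDown-< b≤a a<n p<n

  relocated-positions-≤ : ∀ {L M : Fin n → Fin n} → IsBijection L → IsBijection M →
    (As Bs : List ℕ) → Unique As → All (_< n) As →
    (∀ e → pos L e ∈ As → pos M e ∈ Bs) → length As ≤ length Bs
  relocated-positions-≤ {L} {M} (_ , L-surjective) M-bij As Bs As-unique As<n relocate =
    pigeonhole Relocated Relocated-injective As Bs As-unique (All.tabulate relocated)
    where
    Relocated : ℕ → ℕ → Set
    Relocated q r = ∃ λ e → pos L e ≡ q × pos M e ≡ r
    Relocated-injective : ∀ {q q' r} → Relocated q r → Relocated q' r → q ≡ q'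
    Relocated-injective (e , refl , Me≡r) (e' , refl , Me'≡r) = cong (pos L) (pos-injective M-bij (trans Me≡r (sym Me'≡r)))
    relocated : ∀ {q} → q ∈ As → Any (Relocated q) Bs
    relocated {q} q∈As with L-surjective (fromℕ< (All.lookup As<n q∈As))
    ... | e , Le≡q = Any.map (λ Me≡r → e , pos-Le , Me≡r) (relocate e (subst (_∈ As) (sym pos-Le) q∈As))
      where pos-Le = trans (cong toℕ Le≡q) (toℕ-fromℕ< _)

module Moves {n : ℕ} (P : FinPoset n) where
  open FinPoset P using (_≺_; ≺-dec) renaming (trans to ≺-trans)

  FreeDown : (Fin n → Fin n) → ℕ → Fin n → Set
  FreeDown L lo e = ∀ v → lo ≤ pos L v → pos L v < pos L e → ¬ v ≺ e

  FreeUp : (Fin n → Fin n) → ℕ → Fin n → Set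
  FreeUp L hi e = ∀ v → pos L e < pos L v → pos L v ≤ hi → ¬ e ≺ v

  FreeDown? : ∀ L lo e → Dec (FreeDown L lo e)
  FreeDown? L lo e = FinP.all? (λ v → (lo ≤? pos L v) →-dec ((pos L v <? pos L e) →-dec ¬? (≺-dec v e)))

  FreeUp? : ∀ L hi e → Dec (FreeUp L hi e)
  FreeUp? L hi e = FinP.all? (λ v → (pos L e <? pos L v) →-dec ((pos L v ≤? hi) →-dec ¬? (≺-dec e v)))

  ¬FreeDown⇒blocker : ∀ L lo e → ¬ FreeDown L lo e → ∃ λ v → lo ≤ pos L v × pos L v < pos L e × v ≺ e
  ¬FreeDown⇒blocker L lo e ¬free
    with FinP.any? (λ v → (lo ≤? pos L v) ×-dec (pos L v <? pos L e) ×-dec (≺-dec v e))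
  ... | yes blocker = blocker
  ... | no ¬blocker = ⊥-elim (¬free (λ v lo≤v v<e v≺e → ¬blocker (v , lo≤v , v<e , v≺e)))

  ¬FreeUp⇒blocker : ∀ L hi e → ¬ FreeUp L hi e → ∃ λ v → pos L e < pos L v × pos L v ≤ hi × e ≺ v
  ¬FreeUp⇒blocker L hi e ¬free
    with FinP.any? (λ v → (pos L e <? pos L v) ×-dec (pos L v ≤? hi) ×-dec (≺-dec e v))
  ... | yes blocker = blocker
  ... | no ¬blocker = ⊥-elim (¬free (λ v e<v v≤hi e≺v → ¬blocker (v , e<v , v≤hi , e≺v)))

  moveUp-linearExtension : ∀ {L e b} → IsLinearExtension P L → FreeUp L b e → pos L e ≤ b → b < n →
                           IsLinearExtension P (reindex (moveUp (pos L e) b) L)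
  moveUp-linearExtension {L} {e} {b} (L-bij , L-mono) free e≤b b<n =
    reindex-bijection (moveUp-bounded e≤b b<n) (moveDown-bounded e≤b b<n)
      (λ _ _ → moveDown-moveUp e≤b) (λ _ _ → moveUp-moveDown e≤b) L-bij ,
    λ u v u≺v → subst₂ _<_ (sym (pos-reindex (moveUp-bounded e≤b b<n) L u)) (sym (pos-reindex (moveUp-bounded e≤b b<n) L v))
                  (moveUp-mono-< e≤b (L-mono u v u≺v) (leaps u v u≺v))
    where
    leaps : ∀ u v → u ≺ v → pos L u ≡ pos L e → b < pos L v
    leaps u v u≺v u≡e with pos L v ≤? b
    ... | no v≰b = ≰⇒> v≰b
    ... | yes v≤b = ⊥-elim (free v (subst (_< pos L v) u≡e (L-mono u v u≺v)) v≤b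
                                    (subst (_≺ v) (pos-injective L-bij u≡e) u≺v))

  moveDown-linearExtension : ∀ {L e b} → IsLinearExtension P L → FreeDown L b e → b ≤ pos L e →
                             IsLinearExtension P (reindex (moveDown (pos L e) b) L)
  moveDown-linearExtension {L} {e} {b} (L-bij , L-mono) free b≤e =
    reindex-bijection (moveDown-bounded b≤e e<n) (moveUp-bounded b≤e e<n)
      (λ _ _ → moveUp-moveDown b≤e) (λ _ _ → moveDown-moveUp b≤e) L-bij ,
    λ u v u≺v → subst₂ _<_ (sym (pos-reindex (moveDown-bounded b≤e e<n) L u)) (sym (pos-reindex (moveDown-bounded b≤e e<n) L v))
                  (moveDown-mono-< b≤e (L-mono u v u≺v) (leaps u v u≺v))
    where
    e<n : pos L e < n
    e<n = toℕ<n (L e)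
    leaps : ∀ u v → u ≺ v → pos L v ≡ pos L e → pos L u < b
    leaps u v u≺v v≡e with b ≤? pos L u
    ... | no b≰u = ≰⇒> b≰u
    ... | yes b≤u = ⊥-elim (free u b≤u (subst (pos L u <_) v≡e (L-mono u v u≺v))
                                    (subst (u ≺_) (pos-injective L-bij v≡e) u≺v))

  linearExtension-resp-≗ : ∀ {L L'} → L ≗ L' → IsLinearExtension P L → IsLinearExtension P L'
  linearExtension-resp-≗ {L} {L'} L≗L' ((L-injective , L-surjective) , L-mono) =
    ((λ u v eq → L-injective u v (trans (L≗L' u) (trans eq (sym (L≗L' v))))) ,
     (λ j → proj₁ (L-surjective j) , trans (sym (L≗L' _)) (proj₂ (L-surjective j)))) ,
    (λ u v u≺v → subst₂ _<_ (cong toℕ (L≗L' u)) (cong toℕ (L≗L' v)) (L-mono u v u≺v))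

  FCond-resp-≗ : ∀ {x y z a b L L'} → L ≗ L' → FCond P x y z a b L → FCond P x y z a b L'
  FCond-resp-≗ {x} {y} {z} {a} {b} L≗L' (L-ext , y-gap , z-gap) =
    linearExtension-resp-≗ L≗L' L-ext ,
    subst₂ (λ p q → p ≡ q + a) (cong toℕ (L≗L' y)) (cong toℕ (L≗L' x)) y-gap ,
    subst₂ (λ p q → p ≡ q + b) (cong toℕ (L≗L' z)) (cong toℕ (L≗L' y)) z-gap

  ≺-chain-down : (L : Fin n → Fin n) (Win Anc : Fin n → Set) →
    (∀ e → Win e → ∃ λ v → pos L v < pos L e × (Win v ⊎ Anc v) × v ≺ e) →
    ∀ e → Win e → ∃ λ a → Anc a × a ≺ e
  ≺-chain-down L Win Anc step e win = go (suc (pos L e)) e ≤-refl win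
    where
    go : ∀ fuel e → pos L e < fuel → Win e → ∃ λ a → Anc a × a ≺ e
    go (suc fuel) e e<fuel win with step e win
    ... | v , _   , inj₂ anc , v≺e = v , anc , v≺e
    ... | v , v<e , inj₁ win′ , v≺e with go fuel v (<-≤-trans v<e (s≤s⁻¹ e<fuel)) win′
    ...   | a , anc , a≺v = a , anc , ≺-trans a≺v v≺e

  ≺-chain-up : (L : Fin n → Fin n) (Win Anc : Fin n → Set) →
    (∀ e → Win e → ∃ λ v → pos L e < pos L v × (Win v ⊎ Anc v) × e ≺ v) →
    ∀ e → Win e → ∃ λ a → Anc a × e ≺ a
  ≺-chain-up L Win Anc step e win = go (n ∸ pos L e) e ≤-refl win
    where
    go : ∀ fuel e → n ∸ pos L e ≤ fuel → Win e → ∃ λ a → Anc a × e ≺ a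
    go fuel e e≥ win with step e win
    ... | v , _   , inj₂ anc , e≺v = v , anc , e≺v
    ... | v , e<v , inj₁ win′ , e≺v with fuel | ∸-monoʳ-< e<v (<⇒≤ (toℕ<n (L v)))
    ...   | zero     | v<e′ = ⊥-elim (n≮0 (<-≤-trans v<e′ e≥))
    ...   | suc fuel | v<e′ with go fuel v (s≤s⁻¹ (<-≤-trans v<e′ e≥)) win′
    ...     | a , anc , v≺a = a , anc , ≺-trans e≺v v≺a

  anchor≺stuck-down : ∀ {L} → IsBijection L → ∀ a hi →
    (∀ e → pos L a < pos L e → pos L e < hi → ¬ FreeDown L (pos L a) e) →
    ∀ e → pos L a < pos L e → pos L e < hi → a ≺ e
  anchor≺stuck-down {L} L-bij a hi stuck e a<e e<hi = anchored (≺-chain-down L Stuck (_≡ a) step e (a<e , e<hi))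
    where
    anchored : (∃ λ a' → a' ≡ a × a' ≺ e) → a ≺ e
    anchored (_ , refl , a≺e) = a≺e
    Stuck : Fin n → Set
    Stuck e = pos L a < pos L e × pos L e < hi
    step : ∀ e → Stuck e → ∃ λ v → pos L v < pos L e × (Stuck v ⊎ v ≡ a) × v ≺ e
    step e (a<e , e<hi) with ¬FreeDown⇒blocker L (pos L a) e (stuck e a<e e<hi)
    ... | v , a≤v , v<e , v≺e with pos L a ≟ pos L v
    ...   | yes a≡v = v , v<e , inj₂ (pos-injective L-bij (sym a≡v)) , v≺e
    ...   | no a≢v  = v , v<e , inj₁ (≤∧≢⇒< a≤v a≢v , <-trans v<e e<hi) , v≺e

  stuck-up≺anchor : ∀ {L} → IsBijection L → ∀ lo b →
    (∀ e → lo ≤ pos L e → pos L e < pos L b → ¬ FreeUp L (pos L b) e) →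
    ∀ e → lo ≤ pos L e → pos L e < pos L b → e ≺ b
  stuck-up≺anchor {L} L-bij lo b stuck e lo≤e e<b = anchored (≺-chain-up L Stuck (_≡ b) step e (lo≤e , e<b))
    where
    anchored : (∃ λ b' → b' ≡ b × e ≺ b') → e ≺ b
    anchored (_ , refl , e≺b) = e≺b
    Stuck : Fin n → Set
    Stuck e = lo ≤ pos L e × pos L e < pos L b
    step : ∀ e → Stuck e → ∃ λ v → pos L e < pos L v × (Stuck v ⊎ v ≡ b) × e ≺ v
    step e (lo≤e , e<b) with ¬FreeUp⇒blocker L (pos L b) e (stuck e lo≤e e<b)
    ... | v , e<v , v≤b , e≺v with pos L v ≟ pos L b
    ...   | yes v≡b = v , e<v , inj₂ (pos-injective L-bij v≡b) , e≺v
    ...   | no v≢b  = v , e<v , inj₁ (≤-trans lo≤e (<⇒≤ e<v) , ≤∧≢⇒< v≤b v≢b) , e≺v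

-- Removal: F(k+1, ℓ) ≤ 2kℓ F(k, ℓ)

Tag : Set
Tag = ℕ × ℕ × ℕ

module Removal {n : ℕ} (P : FinPoset n) (x y z : Fin n) (k ℓ : ℕ) (1≤k : 1 ≤ k) (1≤ℓ : 1 ≤ ℓ) where
  open FinPoset P using (_≺_)
  open Moves P

  -- A tag (s , d , e): if e = 0, the element at offset d behind x was moved down onto x's place
  -- (s = 0) or up onto z's place (s > 0); if e = suc E, the element at offset d behind x was first
  -- moved up onto y's place, and then the element at offset E behind it was moved likewise.
  restore : Tag → ℕ → ℕ → ℕ → ℕ → ℕ
  restore (zero  , d , zero)  mx my mz   = moveUp (mx ∸ 1) (mx + d)
  restore (zero  , d , suc E) mx my mz p = moveDown my (mx + d) (moveUp (mx ∸ 1) (my + 1 + E) p)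
  restore (suc _ , d , zero)  mx my mz   = moveDown (mz + 1) (mx + 1 + d)
  restore (suc _ , d , suc E) mx my mz p = moveDown (my + 1) (mx + 1 + d) (moveDown (mz + 1) (my + 2 + E) p)

  decode : Tag → (Fin n → Fin n) → Fin n → Fin n
  decode t M = reindex (restore t (pos M x) (pos M y) (pos M z)) M

  decode-resp-≗ : ∀ t {M M'} → M ≗ M' → decode t M ≗ decode t M'
  decode-resp-≗ t M≗M' u rewrite M≗M' x | M≗M' y | M≗M' z | M≗M' u = refl

  tags : List Tag
  tags = cartesianProduct (upTo 2) (cartesianProduct (upTo k) (upTo ℓ))

  module Encoding (M₀ : Fin n → Fin n) (M₀-F : FCond P x y z k ℓ M₀)
                  (L : Fin n → Fin n) (L-F : FCond P x y z (k + 1) ℓ L) where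
    px : ℕ
    px = pos L x
    py : ℕ
    py = pos L y
    pz : ℕ
    pz = pos L z
    L-ext : IsLinearExtension P L
    L-ext = proj₁ L-F
    L-bij : IsBijection L
    L-bij = proj₁ L-ext
    y-gap : py ≡ suc px + k
    y-gap = trans (proj₁ (proj₂ L-F)) (m+[n+1]≡suc[m]+n px k)
    z-gap : pz ≡ py + ℓ
    z-gap = proj₂ (proj₂ L-F)
    px<py : px < py
    px<py = subst (px <_) (sym y-gap) (s≤s (m≤m+n px k))
    py<pz : py < pz
    py<pz = subst (py <_) (sym z-gap) (m<m+n py 1≤ℓ)
    pz<n : pz < n
    pz<n = toℕ<n (L z)

    Encoded : Set
    Encoded = ∃ λ M → FCond P x y z k ℓ M × Any (λ t → L ≗ decode t M) tags

    tagged : ∀ {s d e} M → s < 2 → d < k → e < ℓ →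
             (∀ u → restore (s , d , e) (pos M x) (pos M y) (pos M z) (pos M u) ≡ pos L u) →
             Any (λ t → L ≗ decode t M) tags
    tagged {s} {d} {e} M s<2 d<k e<ℓ restores =
      lose (∈-cartesianProduct⁺ (∈-upTo s<2) (∈-cartesianProduct⁺ (∈-upTo d<k) (∈-upTo e<ℓ)))
           (≗-reindex (restore (s , d , e) (pos M x) (pos M y) (pos M z)) M L restores)

    inner-down : (e : Fin n) → px < pos L e → pos L e < py → FreeDown L px e → Encoded
    inner-down e x<e e<y free = M , (M-ext , M-y-gap , M-z-gap) , tagged M (s≤s z≤n) d<k 1≤ℓ restores
      where
      a : ℕ
      a = pos L e
      M : Fin n → Fin n
      M = reindex (moveDown a px) L
      pos-M : ∀ u → pos M u ≡ moveDown a px (pos L u)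
      pos-M = pos-reindex (moveDown-bounded (<⇒≤ x<e) (toℕ<n (L e))) L
      M-ext : IsLinearExtension P M
      M-ext = moveDown-linearExtension L-ext free (<⇒≤ x<e)
      Mx : pos M x ≡ suc px
      Mx = trans (pos-M x) (moveDown-between ≤-refl x<e)
      My : pos M y ≡ py
      My = trans (pos-M y) (moveDown-above e<y)
      Mz : pos M z ≡ pz
      Mz = trans (pos-M z) (moveDown-above (<-trans e<y py<pz))
      M-y-gap : pos M y ≡ pos M x + k
      M-y-gap = trans My (trans y-gap (cong (_+ k) (sym Mx)))
      M-z-gap : pos M z ≡ pos M y + ℓ
      M-z-gap = trans Mz (trans z-gap (cong (_+ ℓ) (sym My)))
      d : ℕ
      d = a ∸ suc px
      d<k : d < k
      d<k = n≤m∧m<n+o⇒m∸n<o x<e (subst (a <_) y-gap e<y)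
      restores : ∀ u → restore (0 , d , 0) (pos M x) (pos M y) (pos M z) (pos M u) ≡ pos L u
      restores u = begin
        moveUp (pos M x ∸ 1) (pos M x + d) (pos M u)   ≡⟨ cong₂ (λ m p → moveUp (m ∸ 1) (m + d) p) Mx (pos-M u) ⟩
        moveUp px (suc px + d) (moveDown a px (pos L u)) ≡⟨ cong (λ b → moveUp px b (moveDown a px (pos L u))) (m+[n∸m]≡n x<e) ⟩
        moveUp px a (moveDown a px (pos L u))           ≡⟨ moveUp-moveDown (<⇒≤ x<e) ⟩
        pos L u                                         ∎
        where open ≡-Reasoning

    inner-up : (e : Fin n) → px < pos L e → pos L e < py → FreeUp L pz e → Encoded
    inner-up e x<e e<y free = M , (M-ext , M-y-gap , M-z-gap) , tagged M (s≤s (s≤s z≤n)) d<k 1≤ℓ restores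
      where
      a : ℕ
      a = pos L e
      e≤z : a ≤ pz
      e≤z = <⇒≤ (<-trans e<y py<pz)
      M : Fin n → Fin n
      M = reindex (moveUp a pz) L
      pos-M : ∀ u → pos M u ≡ moveUp a pz (pos L u)
      pos-M = pos-reindex (moveUp-bounded e≤z pz<n) L
      M-ext : IsLinearExtension P M
      M-ext = moveUp-linearExtension L-ext free e≤z pz<n
      Mx : pos M x ≡ px
      Mx = trans (pos-M x) (moveUp-below x<e)
      My : suc (pos M y) ≡ py
      My = trans (cong suc (trans (pos-M y) (moveUp-between e<y (<⇒≤ py<pz)))) (m<n⇒suc[pred[n]]≡n e<y)
      Mz : suc (pos M z) ≡ pz
      Mz = trans (cong suc (trans (pos-M z) (moveUp-between (<-trans e<y py<pz) ≤-refl)))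
                 (m<n⇒suc[pred[n]]≡n (<-trans e<y py<pz))
      M-y-gap : pos M y ≡ pos M x + k
      M-y-gap = suc-injective (trans My (trans y-gap (cong (λ m → suc m + k) (sym Mx))))
      M-z-gap : pos M z ≡ pos M y + ℓ
      M-z-gap = suc-injective (trans Mz (trans z-gap (cong (_+ ℓ) (sym My))))
      d : ℕ
      d = a ∸ suc px
      d<k : d < k
      d<k = n≤m∧m<n+o⇒m∸n<o x<e (subst (a <_) y-gap e<y)
      restores : ∀ u → restore (1 , d , 0) (pos M x) (pos M y) (pos M z) (pos M u) ≡ pos L u
      restores u = begin
        moveDown (pos M z + 1) (pos M x + 1 + d) (pos M u) ≡⟨ cong₂ (λ m p → moveDown m (pos M x + 1 + d) p)
                                                                     (trans (+-comm _ 1) Mz) (pos-M u) ⟩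
        moveDown pz (pos M x + 1 + d) (moveUp a pz (pos L u)) ≡⟨ cong (λ m → moveDown pz (m + 1 + d) (moveUp a pz (pos L u))) Mx ⟩
        moveDown pz (px + 1 + d) (moveUp a pz (pos L u)) ≡⟨ cong (λ b → moveDown pz b (moveUp a pz (pos L u)))
                                                                (trans (cong (_+ d) (+-comm px 1)) (m+[n∸m]≡n x<e)) ⟩
        moveDown pz a (moveUp a pz (pos L u))            ≡⟨ moveDown-moveUp e≤z ⟩
        pos L u                                          ∎
        where open ≡-Reasoning

    m0x : ℕ
    m0x = pos M₀ x
    m0y : ℕ
    m0y = pos M₀ y
    m0z : ℕ
    m0z = pos M₀ z
    M₀-bij : IsBijection M₀
    M₀-bij = proj₁ (proj₁ M₀-F)
    M₀-mono : ∀ u v → u ≺ v → pos M₀ u < pos M₀ v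
    M₀-mono = proj₂ (proj₁ M₀-F)
    M₀-y-gap : m0y ≡ m0x + k
    M₀-y-gap = proj₁ (proj₂ M₀-F)
    M₀-z-gap : m0z ≡ m0y + ℓ
    M₀-z-gap = proj₂ (proj₂ M₀-F)
    m0x<m0y : m0x < m0y
    m0x<m0y = subst (m0x <_) (sym M₀-y-gap) (m<m+n m0x 1≤k)
    m0y<m0z : m0y < m0z
    m0y<m0z = subst (m0y <_) (sym M₀-z-gap) (m<m+n m0y 1≤ℓ)

    Inner : Fin n → Set
    Inner e = px < pos L e × pos L e < py

    InnerStuck : Set
    InnerStuck = ∀ e → Inner e → ¬ FreeDown L px e × ¬ FreeUp L pz e

    x≺inner : InnerStuck → ∀ e → Inner e → x ≺ e
    x≺inner stuck e (x<e , e<y) =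
      anchor≺stuck-down L-bij x py (λ e x<e e<y → proj₁ (stuck e (x<e , e<y))) e x<e e<y

    -- Otherwise all k elements strictly between x and y stay strictly between x and y in M₀,
    -- where there are only k − 1 positions.
    some-inner-free-up-to-y : InnerStuck → ¬ (∀ e → Inner e → ¬ FreeUp L py e)
    some-inner-free-up-to-y stuck all-stuck-up =
      n≰n∸1 1≤k (subst₂ _≤_ (length-interval (suc px) k) (length-interval (suc m0x) (k ∸ 1))
        (relocated-positions-≤ L-bij M₀-bij (interval (suc px) k) (interval (suc m0x) (k ∸ 1))
          (interval-unique _ _) (All.tabulate below-n) relocate))
      where
      inner≺y : ∀ e → Inner e → e ≺ y
      inner≺y e (x<e , e<y) = stuck-up≺anchor L-bij (suc px) y (λ e x<e e<y → all-stuck-up e (x<e , e<y)) e x<e e<y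
      below-n : ∀ {q} → q ∈ interval (suc px) k → q < n
      below-n q∈ = <-trans (subst (_ <_) (sym y-gap) (proj₂ (∈-interval⁻ q∈))) (<-trans py<pz pz<n)
      relocate : ∀ e → pos L e ∈ interval (suc px) k → pos M₀ e ∈ interval (suc m0x) (k ∸ 1)
      relocate e e∈ with ∈-interval⁻ e∈
      ... | x<e , e<y′ = ∈-interval⁺ (M₀-mono x e (x≺inner stuck e e-inner))
                           (subst (_ <_) (trans M₀-y-gap (sym (suc[m]+[n∸1]≡m+n m0x 1≤k))) (M₀-mono e y (inner≺y e e-inner)))
        where e-inner = x<e , subst (_ <_) (sym y-gap) e<y′

    module RaisedToY (stuck : InnerStuck) (w : Fin n) (w-inner : Inner w) (w-free : FreeUp L py w) where
      aw : ℕ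
      aw = pos L w
      w≤y : aw ≤ py
      w≤y = <⇒≤ (proj₂ w-inner)
      py<n : py < n
      py<n = <-trans py<pz pz<n
      L' : Fin n → Fin n
      L' = reindex (moveUp aw py) L
      pos-L' : ∀ u → pos L' u ≡ moveUp aw py (pos L u)
      pos-L' = pos-reindex (moveUp-bounded w≤y py<n) L
      L'-ext : IsLinearExtension P L'
      L'-ext = moveUp-linearExtension L-ext w-free w≤y py<n
      L'-bij : IsBijection L'
      L'-bij = proj₁ L'-ext
      py' : ℕ
      py' = pred py
      suc-py' : suc py' ≡ py
      suc-py' = m<n⇒suc[pred[n]]≡n px<py
      py'≡ : py' ≡ px + k
      py'≡ = cong pred y-gap
      px<py' : px < py'
      px<py' = subst (px <_) (sym py'≡) (m<m+n px 1≤k)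
      py'<pz : py' < pz
      py'<pz = ≤-<-trans pred[n]≤n py<pz
      L'x : pos L' x ≡ px
      L'x = trans (pos-L' x) (moveUp-below (proj₁ w-inner))
      L'y : pos L' y ≡ py'
      L'y = trans (pos-L' y) (moveUp-between (proj₂ w-inner) ≤-refl)
      L'w : pos L' w ≡ py
      L'w = trans (pos-L' w) (moveUp-source refl)
      L'z : pos L' z ≡ pz
      L'z = trans (pos-L' z) (moveUp-above w≤y py<pz)
      unraise : ∀ u → moveDown py aw (pos L' u) ≡ pos L u
      unraise u = trans (cong (moveDown py aw) (pos-L' u)) (moveDown-moveUp w≤y)
      d : ℕ
      d = aw ∸ suc px
      d<k : d < k
      d<k = n≤m∧m<n+o⇒m∸n<o (proj₁ w-inner) (subst (aw <_) y-gap (proj₂ w-inner))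
      sx+d≡w : suc px + d ≡ aw
      sx+d≡w = m+[n∸m]≡n (proj₁ w-inner)

      outer-down : (e : Fin n) → py < pos L' e → pos L' e < pz → FreeDown L' px e → Encoded
      outer-down e y<e e<z free = M , (M-ext , M-y-gap , M-z-gap) , tagged M (s≤s z≤n) d<k sE<ℓ restores
        where
        b : ℕ
        b = pos L' e
        x≤e : px ≤ b
        x≤e = <⇒≤ (<-trans px<py y<e)
        M : Fin n → Fin n
        M = reindex (moveDown b px) L'
        pos-M : ∀ u → pos M u ≡ moveDown b px (pos L' u)
        pos-M = pos-reindex (moveDown-bounded x≤e (toℕ<n (L' e))) L'
        M-ext : IsLinearExtension P M
        M-ext = moveDown-linearExtension L'-ext free x≤e
        Mx : pos M x ≡ suc px
        Mx = trans (pos-M x) (trans (cong (moveDown b px) L'x) (moveDown-between ≤-refl (<-trans px<py y<e)))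
        My : pos M y ≡ py
        My = trans (pos-M y) (trans (cong (moveDown b px) L'y)
               (trans (moveDown-between (<⇒≤ px<py') (≤-<-trans pred[n]≤n y<e)) suc-py'))
        Mz : pos M z ≡ pz
        Mz = trans (pos-M z) (trans (cong (moveDown b px) L'z) (moveDown-above e<z))
        M-y-gap : pos M y ≡ pos M x + k
        M-y-gap = trans My (trans y-gap (cong (_+ k) (sym Mx)))
        M-z-gap : pos M z ≡ pos M y + ℓ
        M-z-gap = trans Mz (trans z-gap (cong (_+ ℓ) (sym My)))
        E : ℕ
        E = b ∸ suc py
        sE<ℓ : suc E < ℓ
        sE<ℓ = subst (_< ℓ) (m<n⇒n∸m≡suc[n∸suc[m]] y<e) (n≤m∧m<n+o⇒m∸n<o (<⇒≤ y<e) (subst (b <_) z-gap e<z))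
        restores : ∀ u → restore (0 , d , suc E) (pos M x) (pos M y) (pos M z) (pos M u) ≡ pos L u
        restores u = begin
          moveDown (pos M y) (pos M x + d) (moveUp (pos M x ∸ 1) (pos M y + 1 + E) (pos M u))
            ≡⟨ cong₂ (λ my mx → moveDown my (mx + d) (moveUp (mx ∸ 1) (my + 1 + E) (pos M u))) My Mx ⟩
          moveDown py (suc px + d) (moveUp px (py + 1 + E) (pos M u))
            ≡⟨ cong₂ (λ a c → moveDown py a (moveUp px c (pos M u)))
                     sx+d≡w (trans (cong (_+ E) (+-comm py 1)) (m+[n∸m]≡n y<e)) ⟩
          moveDown py aw (moveUp px b (pos M u))
            ≡⟨ cong (λ p → moveDown py aw (moveUp px b p)) (pos-M u) ⟩
          moveDown py aw (moveUp px b (moveDown b px (pos L' u)))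
            ≡⟨ cong (moveDown py aw) (moveUp-moveDown x≤e) ⟩
          moveDown py aw (pos L' u)
            ≡⟨ unraise u ⟩
          pos L u ∎
          where open ≡-Reasoning

      outer-up : (e : Fin n) → py < pos L' e → pos L' e < pz → FreeUp L' pz e → Encoded
      outer-up e y<e e<z free = M , (M-ext , M-y-gap , M-z-gap) , tagged M (s≤s (s≤s z≤n)) d<k sE<ℓ restores
        where
        b : ℕ
        b = pos L' e
        e≤z : b ≤ pz
        e≤z = <⇒≤ e<z
        M : Fin n → Fin n
        M = reindex (moveUp b pz) L'
        pos-M : ∀ u → pos M u ≡ moveUp b pz (pos L' u)
        pos-M = pos-reindex (moveUp-bounded e≤z pz<n) L'
        M-ext : IsLinearExtension P M
        M-ext = moveUp-linearExtension L'-ext free e≤z pz<n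
        Mx : pos M x ≡ px
        Mx = trans (pos-M x) (trans (cong (moveUp b pz) L'x) (moveUp-below (<-trans px<py y<e)))
        My : pos M y ≡ py'
        My = trans (pos-M y) (trans (cong (moveUp b pz) L'y) (moveUp-below (≤-<-trans pred[n]≤n y<e)))
        Mz : suc (pos M z) ≡ pz
        Mz = trans (cong suc (trans (pos-M z) (trans (cong (moveUp b pz) L'z) (moveUp-between e<z ≤-refl))))
                   (m<n⇒suc[pred[n]]≡n e<z)
        M-y-gap : pos M y ≡ pos M x + k
        M-y-gap = trans My (trans py'≡ (cong (_+ k) (sym Mx)))
        My+1 : pos M y + 1 ≡ py
        My+1 = trans (+-comm _ 1) (trans (cong suc My) suc-py')
        M-z-gap : pos M z ≡ pos M y + ℓ
        M-z-gap = suc-injective (trans Mz (trans z-gap (cong (_+ ℓ) (trans (sym My+1) (+-comm _ 1)))))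
        E : ℕ
        E = b ∸ suc py
        sE<ℓ : suc E < ℓ
        sE<ℓ = subst (_< ℓ) (m<n⇒n∸m≡suc[n∸suc[m]] y<e) (n≤m∧m<n+o⇒m∸n<o (<⇒≤ y<e) (subst (b <_) z-gap e<z))
        restores : ∀ u → restore (1 , d , suc E) (pos M x) (pos M y) (pos M z) (pos M u) ≡ pos L u
        restores u = begin
          moveDown (pos M y + 1) (pos M x + 1 + d) (moveDown (pos M z + 1) (pos M y + 2 + E) (pos M u))
            ≡⟨ cong₂ (λ a c → moveDown a c (moveDown (pos M z + 1) (pos M y + 2 + E) (pos M u)))
                     My+1 (trans (cong (λ m → m + 1 + d) Mx) (trans (cong (_+ d) (+-comm px 1)) sx+d≡w)) ⟩
          moveDown py aw (moveDown (pos M z + 1) (pos M y + 2 + E) (pos M u))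
            ≡⟨ cong₂ (λ a c → moveDown py aw (moveDown a c (pos M u)))
                     (trans (+-comm _ 1) Mz) (trans (cong (λ m → m + 2 + E) My) (trans (cong (_+ E) (trans (+-comm py' 2) (cong suc suc-py'))) (m+[n∸m]≡n y<e))) ⟩
          moveDown py aw (moveDown pz b (pos M u))
            ≡⟨ cong (λ p → moveDown py aw (moveDown pz b p)) (pos-M u) ⟩
          moveDown py aw (moveDown pz b (moveUp b pz (pos L' u)))
            ≡⟨ cong (moveDown py aw) (moveDown-moveUp e≤z) ⟩
          moveDown py aw (pos L' u)
            ≡⟨ unraise u ⟩
          pos L u ∎
          where open ≡-Reasoning

      Inner' : Fin n → Set
      Inner' e = px < pos L' e × pos L' e < pz × pos L' e ≢ py'

      inner'⇒inner : ∀ e → px < pos L' e → pos L' e < py → pos L' e ≢ py' → Inner e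
      inner'⇒inner e x<e e<y e≢y with pos L' e <? aw
      ... | yes e<w = subst (λ q → px < q × q < py) (trans (sym (moveDown-below w≤y e<w)) (unraise e)) (x<e , e<y)
      ... | no e≮w  = subst (λ q → px < q × q < py) (trans (sym (moveDown-between (≮⇒≥ e≮w) e<y)) (unraise e))
                        (<-trans x<e (n<1+n _) , ≤∧≢⇒< e<y (λ se≡y → e≢y (cong pred se≡y)))

      classify-down : ∀ v → px ≤ pos L' v → pos L' v < pz → Inner' v ⊎ (v ≡ x ⊎ v ≡ y)
      classify-down v x≤v v<z with relative {px} {py'} {pz} x≤v (<⇒≤ v<z)
      ... | at-lo v≡x            = inj₂ (inj₁ (pos-injective L'-bij (trans v≡x (sym L'x))))
      ... | at-mid v≡y           = inj₂ (inj₂ (pos-injective L'-bij (trans v≡y (sym L'y))))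
      ... | at-hi v≡z            = ⊥-elim (<-irrefl v≡z v<z)
      ... | inner x<v v<z′ v≢y   = inj₁ (x<v , v<z′ , v≢y)

      classify-up : ∀ v → px < pos L' v → pos L' v ≤ pz → Inner' v ⊎ (v ≡ y ⊎ v ≡ z)
      classify-up v x<v v≤z with relative {px} {py'} {pz} (<⇒≤ x<v) v≤z
      ... | at-lo v≡x            = ⊥-elim (<-irrefl (sym v≡x) x<v)
      ... | at-mid v≡y           = inj₂ (inj₁ (pos-injective L'-bij (trans v≡y (sym L'y))))
      ... | at-hi v≡z            = inj₂ (inj₂ (pos-injective L'-bij (trans v≡z (sym L'z))))
      ... | inner x<v′ v<z v≢y   = inj₁ (x<v′ , v<z , v≢y)

      module _ (outer-stuck : ∀ e → py < pos L' e → pos L' e < pz → ¬ FreeDown L' px e × ¬ FreeUp L' pz e) where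

        step-down : ∀ e → Inner' e → ∃ λ v → pos L' v < pos L' e × (Inner' v ⊎ (v ≡ x ⊎ v ≡ y)) × v ≺ e
        step-down e (x<e , e<z , e≢y) with <-cmp (pos L' e) py
        ... | tri< e<y _ _ = x , subst (_< pos L' e) (sym L'x) x<e , inj₂ (inj₁ refl) , x≺inner stuck e (inner'⇒inner e x<e e<y e≢y)
        ... | tri≈ _ e≡y _ with pos-injective L'-bij (trans e≡y (sym L'w))
        ...   | refl with ¬FreeDown⇒blocker L px w (proj₁ (stuck w w-inner))
        ...     | v , x≤v , v<w , v≺w = v , v<e , classify-down v (subst (px ≤_) (sym L'v) x≤v) (<-trans v<e e<z) , v≺w
          where
          L'v : pos L' v ≡ pos L v
          L'v = trans (pos-L' v) (moveUp-below v<w)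
          v<e : pos L' v < pos L' e
          v<e = subst₂ _<_ (sym L'v) (sym e≡y) (<-trans v<w (proj₂ w-inner))
        step-down e (x<e , e<z , e≢y) | tri> _ _ y<e with ¬FreeDown⇒blocker L' px e (proj₁ (outer-stuck e y<e e<z))
        ... | v , x≤v , v<e , v≺e = v , v<e , classify-down v x≤v (<-trans v<e e<z) , v≺e

        step-up : ∀ e → Inner' e → ∃ λ v → pos L' e < pos L' v × (Inner' v ⊎ (v ≡ y ⊎ v ≡ z)) × e ≺ v
        step-up e (x<e , e<z , e≢y) with <-cmp (pos L' e) py
        ... | tri< e<y _ _ with ¬FreeUp⇒blocker L pz e (proj₂ (stuck e (inner'⇒inner e x<e e<y e≢y)))
        ...   | v , e<v , v≤z , e≺v = v , e<v′ , classify-up v (<-trans x<e e<v′) v≤z′ , e≺v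
          where
          e<v′ : pos L' e < pos L' v
          e<v′ = subst₂ _<_ (sym (pos-L' e)) (sym (pos-L' v))
                   (moveUp-mono-< w≤y e<v (λ e≡w → ⊥-elim (<-irrefl (trans (cong (pos L') (pos-injective L-bij e≡w)) L'w) e<y)))
          v≤z′ : pos L' v ≤ pz
          v≤z′ = subst (_≤ pz) (sym (pos-L' v)) (moveUp-≤ w≤y v≤z (<⇒≤ py<pz))
        step-up e (x<e , e<z , e≢y) | tri≈ _ e≡y _ with pos-injective L'-bij (trans e≡y (sym L'w))
        ... | refl with ¬FreeUp⇒blocker L pz w (proj₂ (stuck w w-inner))
        ...   | v , w<v , v≤z , w≺v with pos L v ≤? py
        ...     | yes v≤y = ⊥-elim (w-free v w<v v≤y w≺v)
        ...     | no v≰y = v , e<v , classify-up v (<-trans x<e e<v) (subst (_≤ pz) (sym L'v) v≤z) , w≺v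
          where
          L'v : pos L' v ≡ pos L v
          L'v = trans (pos-L' v) (moveUp-above w≤y (≰⇒> v≰y))
          e<v : pos L' e < pos L' v
          e<v = subst₂ _<_ (sym e≡y) (sym L'v) (≰⇒> v≰y)
        step-up e (x<e , e<z , e≢y) | tri> _ _ y<e with ¬FreeUp⇒blocker L' pz e (proj₂ (outer-stuck e y<e e<z))
        ... | v , e<v , v≤z , e≺v = v , e<v , classify-up v (<-trans x<e e<v) v≤z , e≺v

        -- The k − 1 + ℓ elements of Inner' would stay strictly between x and z in M₀ and avoid y,
        -- where only (k − 1) + (ℓ − 1) positions are available.
        outer-not-stuck : ⊥
        outer-not-stuck = n≰n∸1 1≤ℓ (+-cancelˡ-≤ (k ∸ 1) ℓ (ℓ ∸ 1)
          (subst₂ _≤_ (trans (length-innerPositions px py' pz) (cong₂ _+_ L'-left L'-right))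
                      (trans (length-innerPositions m0x m0y m0z) (cong₂ _+_ M₀-left M₀-right))
            (relocated-positions-≤ L'-bij M₀-bij (innerPositions px py' pz) (innerPositions m0x m0y m0z)
              (innerPositions-unique px py' pz px<py') (All.tabulate below-n) relocate)))
          where
          L'-left : py' ∸ suc px ≡ k ∸ 1
          L'-left = trans (cong (_∸ suc px) py'≡) (m+n∸suc[m]≡n∸1 px k)
          L'-right : pz ∸ suc py' ≡ ℓ
          L'-right = trans (cong₂ _∸_ z-gap suc-py') (m+n∸m≡n py ℓ)
          M₀-left : m0y ∸ suc m0x ≡ k ∸ 1
          M₀-left = trans (cong (_∸ suc m0x) M₀-y-gap) (m+n∸suc[m]≡n∸1 m0x k)
          M₀-right : m0z ∸ suc m0y ≡ ℓ ∸ 1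
          M₀-right = trans (cong (_∸ suc m0y) M₀-z-gap) (m+n∸suc[m]≡n∸1 m0y ℓ)
          above-x : ∀ e → Inner' e → m0x < pos M₀ e
          above-x e e-inner with ≺-chain-down L' Inner' (λ a → a ≡ x ⊎ a ≡ y) step-down e e-inner
          ... | _ , inj₁ refl , x≺e = M₀-mono x e x≺e
          ... | _ , inj₂ refl , y≺e = <-trans m0x<m0y (M₀-mono y e y≺e)
          below-z : ∀ e → Inner' e → pos M₀ e < m0z
          below-z e e-inner with ≺-chain-up L' Inner' (λ a → a ≡ y ⊎ a ≡ z) step-up e e-inner
          ... | _ , inj₁ refl , e≺y = <-trans (M₀-mono e y e≺y) m0y<m0z
          ... | _ , inj₂ refl , e≺z = M₀-mono e z e≺z
          not-y : ∀ e → Inner' e → pos M₀ e ≢ m0y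
          not-y e (_ , _ , e≢y) e≡y with pos-injective M₀-bij e≡y
          ... | refl = e≢y L'y
          below-n : ∀ {q} → q ∈ innerPositions px py' pz → q < n
          below-n q∈ = <-trans (proj₁ (proj₂ (∈-innerPositions⁻ px<py' py'<pz q∈))) pz<n
          relocate : ∀ e → pos L' e ∈ innerPositions px py' pz → pos M₀ e ∈ innerPositions m0x m0y m0z
          relocate e e∈ = ∈-innerPositions⁺ (above-x e e-inner) (below-z e e-inner) (not-y e e-inner)
            where e-inner = ∈-innerPositions⁻ px<py' py'<pz e∈

      encode : Encoded
      encode with FinP.any? (λ e → ((py <? pos L' e) ×-dec (pos L' e <? pz)) ×-dec (FreeDown? L' px e ⊎-dec FreeUp? L' pz e))
      ... | yes (e , (y<e , e<z) , inj₁ free) = outer-down e y<e e<z free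
      ... | yes (e , (y<e , e<z) , inj₂ free) = outer-up e y<e e<z free
      ... | no none = ⊥-elim (outer-not-stuck (λ e y<e e<z → (λ free → none (e , (y<e , e<z) , inj₁ free)) ,
                                                            (λ free → none (e , (y<e , e<z) , inj₂ free))))

    encode-stuck : InnerStuck → Encoded
    encode-stuck stuck with FinP.any? (λ w → ((px <? pos L w) ×-dec (pos L w <? py)) ×-dec FreeUp? L py w)
    ... | yes (w , w-inner , w-free) = RaisedToY.encode stuck w w-inner w-free
    ... | no none = ⊥-elim (some-inner-free-up-to-y stuck (λ e e-inner free → none (e , e-inner , free)))

    encode : Encoded
    encode with FinP.any? (λ e → ((px <? pos L e) ×-dec (pos L e <? py)) ×-dec (FreeDown? L px e ⊎-dec FreeUp? L pz e))
    ... | yes (e , (x<e , e<y) , inj₁ free) = inner-down e x<e e<y free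
    ... | yes (e , (x<e , e<y) , inj₂ free) = inner-up e x<e e<y free
    ... | no none = encode-stuck (λ e e-inner → (λ free → none (e , e-inner , inj₁ free)) ,
                                                 (λ free → none (e , e-inner , inj₂ free)))

  removal : 0 < F P x y z k ℓ → F P x y z (k + 1) ℓ ≤ 2 * k * ℓ * F P x y z k ℓ
  removal F>0 with M₀ , M₀-F ← filter-nonempty (FCond? P x y z k ℓ) (allFuns n n) F>0 =
    subst (λ c → F P x y z (k + 1) ℓ ≤ c * F P x y z k ℓ) #tags
      (count-by-decoding (FCond? P x y z (k + 1) ℓ) (FCond? P x y z k ℓ) FCond-resp-≗ tags decode decode-resp-≗
                         (λ L L-F → Encoding.encode M₀ M₀-F L L-F))
    where
    #tags : length tags ≡ 2 * k * ℓ
    #tags = begin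
      length tags                                   ≡⟨ length-cartesianProduct (upTo 2) (cartesianProduct (upTo k) (upTo ℓ)) ⟩
      length (upTo 2) * length (cartesianProduct (upTo k) (upTo ℓ)) ≡⟨ cong (2 *_) (length-cartesianProduct (upTo k) (upTo ℓ)) ⟩
      2 * (length (upTo k) * length (upTo ℓ))       ≡⟨ cong₂ (λ a b → 2 * (a * b)) (length-upTo k) (length-upTo ℓ) ⟩
      2 * (k * ℓ)                                   ≡⟨ *-assoc 2 k ℓ ⟨
      2 * k * ℓ                                     ∎
      where open ≡-Reasoning

-- Insertion: F(k, ℓ+1) ≤ n(ℓ+1) F(k+1, ℓ+1)

module Insertion {n : ℕ} (P : FinPoset n) (x y z : Fin n) (k ℓ : ℕ) (1≤k : 1 ≤ k) where
  open FinPoset P using (_≺_)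
  open Moves P

  -- A tag (a , E): a is the original position of the element moved first. If a lies below x, it
  -- was moved up onto x's place; otherwise it lay beyond z and was moved down onto z's place,
  -- after which the element at offset E behind y was moved down onto y's place.
  restore : ℕ × ℕ → ℕ → ℕ → ℕ → ℕ → ℕ
  restore (a , E) mx my mz p with a ≤? mx
  ... | yes _ = moveDown (mx + 1) a p
  ... | no _  = moveUp (mz ∸ 1) a (moveUp (my ∸ 1) (my + E) p)

  restore-≤ : ∀ {a E mx my mz} p → a ≤ mx → restore (a , E) mx my mz p ≡ moveDown (mx + 1) a p
  restore-≤ {a} {mx = mx} p a≤mx with a ≤? mx
  ... | yes _   = refl
  ... | no a≰mx = ⊥-elim (a≰mx a≤mx)

  restore-> : ∀ {a E mx my mz} p → mx < a → restore (a , E) mx my mz p ≡ moveUp (mz ∸ 1) a (moveUp (my ∸ 1) (my + E) p)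
  restore-> {a} {mx = mx} p mx<a with a ≤? mx
  ... | yes a≤mx = ⊥-elim (<⇒≱ mx<a a≤mx)
  ... | no _     = refl

  decode : ℕ × ℕ → (Fin n → Fin n) → Fin n → Fin n
  decode t M = reindex (restore t (pos M x) (pos M y) (pos M z)) M

  decode-resp-≗ : ∀ t {M M'} → M ≗ M' → decode t M ≗ decode t M'
  decode-resp-≗ t M≗M' u rewrite M≗M' x | M≗M' y | M≗M' z | M≗M' u = refl

  tags : List (ℕ × ℕ)
  tags = cartesianProduct (upTo n) (upTo (ℓ + 1))

  module Encoding (B₀ : Fin n → Fin n) (B₀-F : FCond P x y z (k + 1) (ℓ + 1) B₀)
                  (L : Fin n → Fin n) (L-F : FCond P x y z k (ℓ + 1) L) where
    px : ℕ
    px = pos L x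
    py : ℕ
    py = pos L y
    pz : ℕ
    pz = pos L z
    L-ext : IsLinearExtension P L
    L-ext = proj₁ L-F
    L-bij : IsBijection L
    L-bij = proj₁ L-ext
    y-gap : py ≡ px + k
    y-gap = proj₁ (proj₂ L-F)
    z-gap : pz ≡ py + (ℓ + 1)
    z-gap = proj₂ (proj₂ L-F)
    px<py : px < py
    px<py = subst (px <_) (sym y-gap) (m<m+n px 1≤k)
    py<pz : py < pz
    py<pz = subst (py <_) (sym z-gap) (m<m+n py (subst (1 ≤_) (+-comm 1 ℓ) (s≤s z≤n)))
    b0x : ℕ
    b0x = pos B₀ x
    b0y : ℕ
    b0y = pos B₀ y
    b0z : ℕ
    b0z = pos B₀ z
    B₀-bij : IsBijection B₀
    B₀-bij = proj₁ (proj₁ B₀-F)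
    B₀-mono : ∀ u v → u ≺ v → pos B₀ u < pos B₀ v
    B₀-mono = proj₂ (proj₁ B₀-F)
    B₀-y-gap : b0y ≡ b0x + (k + 1)
    B₀-y-gap = proj₁ (proj₂ B₀-F)
    B₀-z-gap : b0z ≡ b0y + (ℓ + 1)
    B₀-z-gap = proj₂ (proj₂ B₀-F)
    b0x<b0y : b0x < b0y
    b0x<b0y = subst (b0x <_) (sym B₀-y-gap) (m<m+n b0x (subst (1 ≤_) (+-comm 1 k) (s≤s z≤n)))
    b0y<b0z : b0y < b0z
    b0y<b0z = subst (b0y <_) (sym B₀-z-gap) (m<m+n b0y (subst (1 ≤_) (+-comm 1 ℓ) (s≤s z≤n)))

    Encoded : Set
    Encoded = ∃ λ M → FCond P x y z (k + 1) (ℓ + 1) M × Any (λ t → L ≗ decode t M) tags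

    tagged : ∀ {a E} M → a < n → E < ℓ + 1 →
             (∀ u → restore (a , E) (pos M x) (pos M y) (pos M z) (pos M u) ≡ pos L u) →
             Any (λ t → L ≗ decode t M) tags
    tagged {a} {E} M a<n E<ℓ+1 restores =
      lose (∈-cartesianProduct⁺ (∈-upTo a<n) (∈-upTo E<ℓ+1))
           (≗-reindex (restore (a , E) (pos M x) (pos M y) (pos M z)) M L restores)

    absorb-left : (e : Fin n) → pos L e < px → FreeUp L px e → Encoded
    absorb-left e e<x free = M , (M-ext , M-y-gap , M-z-gap) , tagged M (toℕ<n (L e)) (subst (0 <_) (+-comm 1 ℓ) (s≤s z≤n)) restores
      where
      a : ℕ
      a = pos L e
      e≤x : a ≤ px
      e≤x = <⇒≤ e<x
      px<n : px < n
      px<n = toℕ<n (L x)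
      M : Fin n → Fin n
      M = reindex (moveUp a px) L
      pos-M : ∀ u → pos M u ≡ moveUp a px (pos L u)
      pos-M = pos-reindex (moveUp-bounded e≤x px<n) L
      M-ext : IsLinearExtension P M
      M-ext = moveUp-linearExtension L-ext free e≤x px<n
      Mx+1 : pos M x + 1 ≡ px
      Mx+1 = trans (+-comm _ 1) (trans (cong suc (trans (pos-M x) (moveUp-between e<x ≤-refl))) (m<n⇒suc[pred[n]]≡n e<x))
      My : pos M y ≡ py
      My = trans (pos-M y) (moveUp-above e≤x px<py)
      Mz : pos M z ≡ pz
      Mz = trans (pos-M z) (moveUp-above e≤x (<-trans px<py py<pz))
      M-y-gap : pos M y ≡ pos M x + (k + 1)
      M-y-gap = trans My (trans y-gap (trans (cong (_+ k) (sym Mx+1)) (trans (+-assoc (pos M x) 1 k) (cong (pos M x +_) (+-comm 1 k)))))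
      M-z-gap : pos M z ≡ pos M y + (ℓ + 1)
      M-z-gap = trans Mz (trans z-gap (cong (_+ (ℓ + 1)) (sym My)))
      a≤Mx : a ≤ pos M x
      a≤Mx = s≤s⁻¹ (subst (a <_) (trans (sym Mx+1) (+-comm _ 1)) e<x)
      restores : ∀ u → restore (a , 0) (pos M x) (pos M y) (pos M z) (pos M u) ≡ pos L u
      restores u = begin
        restore (a , 0) (pos M x) (pos M y) (pos M z) (pos M u) ≡⟨ restore-≤ (pos M u) a≤Mx ⟩
        moveDown (pos M x + 1) a (pos M u)                      ≡⟨ cong₂ (λ m p → moveDown m a p) Mx+1 (pos-M u) ⟩
        moveDown px a (moveUp a px (pos L u))                   ≡⟨ moveDown-moveUp e≤x ⟩
        pos L u                                                 ∎
        where open ≡-Reasoning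

    sunk : Fin n → Fin n → Fin n
    sunk e = reindex (moveDown (pos L e) pz) L

    Sinkable : Fin n → Fin n → Set
    Sinkable e j = (py < pos (sunk e) j × pos (sunk e) j ≤ pz) × FreeDown (sunk e) py j

    Sinkable? : ∀ e j → Dec (Sinkable e j)
    Sinkable? e j = ((py <? pos (sunk e) j) ×-dec (pos (sunk e) j ≤? pz)) ×-dec FreeDown? (sunk e) py j

    module SunkToZ (e : Fin n) (z<e : pz < pos L e) (e-free : FreeDown L pz e) where
      a : ℕ
      a = pos L e
      z≤e : pz ≤ a
      z≤e = <⇒≤ z<e
      L' : Fin n → Fin n
      L' = sunk e
      pos-L' : ∀ u → pos L' u ≡ moveDown a pz (pos L u)
      pos-L' = pos-reindex (moveDown-bounded z≤e (toℕ<n (L e))) L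
      L'-ext : IsLinearExtension P L'
      L'-ext = moveDown-linearExtension L-ext e-free z≤e
      L'-bij : IsBijection L'
      L'-bij = proj₁ L'-ext
      L'x : pos L' x ≡ px
      L'x = trans (pos-L' x) (moveDown-below z≤e (<-trans px<py py<pz))
      L'y : pos L' y ≡ py
      L'y = trans (pos-L' y) (moveDown-below z≤e py<pz)
      L'z : pos L' z ≡ suc pz
      L'z = trans (pos-L' z) (moveDown-between ≤-refl z<e)
      L'e : pos L' e ≡ pz
      L'e = trans (pos-L' e) (moveDown-source refl)

      absorb-right : (j : Fin n) → Sinkable e j → Encoded
      absorb-right j ((y<j , j≤z) , j-free) =
        M , (M-ext , M-y-gap , M-z-gap) , tagged M (toℕ<n (L e)) E<ℓ+1 restores
        where
        b : ℕ
        b = pos L' j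
        y≤j : py ≤ b
        y≤j = <⇒≤ y<j
        M : Fin n → Fin n
        M = reindex (moveDown b py) L'
        pos-M : ∀ u → pos M u ≡ moveDown b py (pos L' u)
        pos-M = pos-reindex (moveDown-bounded y≤j (toℕ<n (L' j))) L'
        M-ext : IsLinearExtension P M
        M-ext = moveDown-linearExtension L'-ext j-free y≤j
        Mx : pos M x ≡ px
        Mx = trans (pos-M x) (trans (cong (moveDown b py) L'x) (moveDown-below y≤j px<py))
        My : pos M y ≡ suc py
        My = trans (pos-M y) (trans (cong (moveDown b py) L'y) (moveDown-between ≤-refl y<j))
        Mz : pos M z ≡ suc pz
        Mz = trans (pos-M z) (trans (cong (moveDown b py) L'z) (moveDown-above (s≤s j≤z)))
        M-y-gap : pos M y ≡ pos M x + (k + 1)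
        M-y-gap = trans My (trans (cong suc y-gap) (trans (sym (m+[n+1]≡suc[m]+n px k)) (cong (_+ (k + 1)) (sym Mx))))
        M-z-gap : pos M z ≡ pos M y + (ℓ + 1)
        M-z-gap = trans Mz (trans (cong suc z-gap) (cong (_+ (ℓ + 1)) (sym My)))
        E : ℕ
        E = b ∸ suc py
        E<ℓ+1 : E < ℓ + 1
        E<ℓ+1 = n≤m∧m<n+o⇒m∸n<o y<j (subst (b <_) (cong suc z-gap) (s≤s j≤z))
        Mx<a : pos M x < a
        Mx<a = subst (_< a) (sym Mx) (<-trans px<py (<-trans py<pz z<e))
        restores : ∀ u → restore (a , E) (pos M x) (pos M y) (pos M z) (pos M u) ≡ pos L u
        restores u = begin
          restore (a , E) (pos M x) (pos M y) (pos M z) (pos M u)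
            ≡⟨ restore-> (pos M u) Mx<a ⟩
          moveUp (pos M z ∸ 1) a (moveUp (pos M y ∸ 1) (pos M y + E) (pos M u))
            ≡⟨ cong₂ (λ mz my → moveUp (mz ∸ 1) a (moveUp (my ∸ 1) (my + E) (pos M u))) Mz My ⟩
          moveUp pz a (moveUp py (suc py + E) (pos M u))
            ≡⟨ cong₂ (λ c p → moveUp pz a (moveUp py c p)) (m+[n∸m]≡n y<j) (pos-M u) ⟩
          moveUp pz a (moveUp py b (moveDown b py (pos L' u)))
            ≡⟨ cong (moveUp pz a) (moveUp-moveDown y≤j) ⟩
          moveUp pz a (pos L' u)
            ≡⟨ cong (moveUp pz a) (pos-L' u) ⟩
          moveUp pz a (moveDown a pz (pos L u))
            ≡⟨ moveUp-moveDown z≤e ⟩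
          pos L u ∎
          where open ≡-Reasoning

    module _ (before-stuck : ∀ e → pos L e < px → ¬ FreeUp L px e) where

      B₀-above-x⇒above-x : ∀ c → b0x < pos B₀ c → px < pos L c
      B₀-above-x⇒above-x c x<c with <-cmp (pos L c) px
      ... | tri< c<x _ _ = ⊥-elim (<-asym x<c (B₀-mono c x (stuck-up≺anchor L-bij 0 x (λ e _ → before-stuck e) c z≤n c<x)))
      ... | tri≈ _ c≡x _ with pos-injective L-bij c≡x
      ...   | refl = ⊥-elim (<-irrefl refl x<c)
      B₀-above-x⇒above-x c x<c | tri> _ _ x<c′ = x<c′

      module _ (none-sinkable : ∀ e → pz < pos L e → FreeDown L pz e → ∀ j → ¬ Sinkable e j) where

        module _ (e : Fin n) (z<e : pz < pos L e) (e-free : FreeDown L pz e) where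
          open SunkToZ e z<e e-free

          y≺sunk-window : ∀ j → py < pos L' j → pos L' j ≤ pz → y ≺ j
          y≺sunk-window j y<j j≤z = anchor≺stuck-down L'-bij y (suc pz) stuck j (subst (_< pos L' j) (sym L'y) y<j) (s≤s j≤z)
            where
            stuck : ∀ j → pos L' y < pos L' j → pos L' j < suc pz → ¬ FreeDown L' (pos L' y) j
            stuck j y<j j<sz free = none-sinkable e z<e e-free j
              ((subst (_< pos L' j) L'y y<j , s≤s⁻¹ j<sz) , subst (λ q → FreeDown L' q j) L'y free)

          y≺between-y-and-z : ∀ j → py < pos L j → pos L j < pz → y ≺ j
          y≺between-y-and-z j y<j j<z = y≺sunk-window j (subst (py <_) (sym L'j) y<j) (subst (_≤ pz) (sym L'j) (<⇒≤ j<z))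
            where L'j = trans (pos-L' j) (moveDown-below z≤e j<z)

          y≺sinkable : y ≺ e
          y≺sinkable = y≺sunk-window e (subst (py <_) (sym L'e) py<pz) (subst (_≤ pz) (sym L'e) ≤-refl)

        beyond-z-above-y-or-z : ∀ c → pz < pos L c → y ≺ c ⊎ z ≺ c
        beyond-z-above-y-or-z c z<c with ≺-chain-down L (λ c → pz < pos L c) (λ a → a ≡ y ⊎ a ≡ z) step c z<c
          where
          step : ∀ c → pz < pos L c → ∃ λ v → pos L v < pos L c × ((pz < pos L v) ⊎ (v ≡ y ⊎ v ≡ z)) × v ≺ c
          step c z<c with FreeDown? L pz c
          ... | yes c-free = y , <-trans py<pz z<c , inj₂ (inj₁ refl) , y≺sinkable c z<c c-free
          ... | no c-stuck with ¬FreeDown⇒blocker L pz c c-stuck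
          ...   | v , z≤v , v<c , v≺c with pz ≟ pos L v
          ...     | yes z≡v = v , v<c , inj₂ (inj₂ (pos-injective L-bij (sym z≡v))) , v≺c
          ...     | no z≢v  = v , v<c , inj₁ (≤∧≢⇒< z≤v z≢v) , v≺c
        ... | _ , inj₁ refl , y≺c = inj₁ y≺c
        ... | _ , inj₂ refl , z≺c = inj₂ z≺c

        B₀-below-y⇒below-y : ∀ e → pz < pos L e → FreeDown L pz e → ∀ c → pos B₀ c < b0y → pos L c < py
        B₀-below-y⇒below-y e z<e e-free c c<y with <-cmp (pos L c) py | <-cmp (pos L c) pz
        ... | tri< c<y′ _ _ | _ = c<y′
        ... | tri≈ _ c≡y _ | _ with pos-injective L-bij c≡y
        ...   | refl = ⊥-elim (<-irrefl refl c<y)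
        B₀-below-y⇒below-y e z<e e-free c c<y | tri> _ _ y<c | tri< c<z _ _ =
          ⊥-elim (<-asym c<y (B₀-mono y c (y≺between-y-and-z e z<e e-free c y<c c<z)))
        B₀-below-y⇒below-y e z<e e-free c c<y | tri> _ _ _ | tri≈ _ c≡z _ with pos-injective L-bij c≡z
        ... | refl = ⊥-elim (<-asym c<y b0y<b0z)
        B₀-below-y⇒below-y e z<e e-free c c<y | tri> _ _ _ | tri> _ _ z<c with beyond-z-above-y-or-z c z<c
        ... | inj₁ y≺c = ⊥-elim (<-asym c<y (B₀-mono y c y≺c))
        ... | inj₂ z≺c = ⊥-elim (<-asym (<-trans c<y b0y<b0z) (B₀-mono z c z≺c))

        -- The k elements strictly between x and y in B₀ would lie strictly between x and y in L,
        -- where there are only k − 1 positions.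
        sinking-impossible : ∀ e → pz < pos L e → ¬ FreeDown L pz e
        sinking-impossible e z<e e-free =
          n≰n∸1 1≤k (subst₂ _≤_ (length-interval (suc b0x) k) (length-interval (suc px) (k ∸ 1))
            (relocated-positions-≤ B₀-bij L-bij (interval (suc b0x) k) (interval (suc px) (k ∸ 1))
              (interval-unique _ _) (All.tabulate below-n) relocate))
          where
          sx+k≡y : suc b0x + k ≡ b0y
          sx+k≡y = trans (sym (m+[n+1]≡suc[m]+n b0x k)) (sym B₀-y-gap)
          below-n : ∀ {q} → q ∈ interval (suc b0x) k → q < n
          below-n q∈ = <-trans (subst (_ <_) sx+k≡y (proj₂ (∈-interval⁻ q∈))) (toℕ<n (B₀ y))
          relocate : ∀ c → pos B₀ c ∈ interval (suc b0x) k → pos L c ∈ interval (suc px) (k ∸ 1)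
          relocate c c∈ with ∈-interval⁻ c∈
          ... | x<c , c<y = ∈-interval⁺ (B₀-above-x⇒above-x c x<c)
                              (subst (pos L c <_) (trans y-gap (sym (suc[m]+[n∸1]≡m+n px 1≤k)))
                                (B₀-below-y⇒below-y e z<e e-free c (subst (_ <_) sx+k≡y c<y)))

      module _ (after-stuck : ∀ e → pz < pos L e → ¬ FreeDown L pz e) where

        z≺beyond-z : ∀ c → pz < pos L c → z ≺ c
        z≺beyond-z c z<c = anchor≺stuck-down L-bij z n (λ e z<e _ → after-stuck e z<e) c z<c (toℕ<n (L c))

        -- The k + ℓ elements strictly between x and z in B₀ other than y would lie strictly between
        -- x and z in L, avoiding y, where only (k − 1) + ℓ positions are available.
        stuck-impossible : ⊥
        stuck-impossible = n≰n∸1 1≤k (+-cancelʳ-≤ ℓ k (k ∸ 1)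
          (subst₂ _≤_ (trans (length-innerPositions b0x b0y b0z) (cong₂ _+_ B₀-left B₀-right))
                      (trans (length-innerPositions px py pz) (cong₂ _+_ L-left L-right))
            (relocated-positions-≤ B₀-bij L-bij (innerPositions b0x b0y b0z) (innerPositions px py pz)
              (innerPositions-unique b0x b0y b0z b0x<b0y) (All.tabulate below-n) relocate)))
          where
          B₀-left : b0y ∸ suc b0x ≡ k
          B₀-left = trans (cong (_∸ suc b0x) B₀-y-gap) (trans (m+n∸suc[m]≡n∸1 b0x (k + 1)) (m+n∸n≡m k 1))
          B₀-right : b0z ∸ suc b0y ≡ ℓ
          B₀-right = trans (cong (_∸ suc b0y) B₀-z-gap) (trans (m+n∸suc[m]≡n∸1 b0y (ℓ + 1)) (m+n∸n≡m ℓ 1))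
          L-left : py ∸ suc px ≡ k ∸ 1
          L-left = trans (cong (_∸ suc px) y-gap) (m+n∸suc[m]≡n∸1 px k)
          L-right : pz ∸ suc py ≡ ℓ
          L-right = trans (cong (_∸ suc py) z-gap) (trans (m+n∸suc[m]≡n∸1 py (ℓ + 1)) (m+n∸n≡m ℓ 1))
          B₀-below-z⇒below-z : ∀ c → pos B₀ c < b0z → pos L c < pz
          B₀-below-z⇒below-z c c<z with <-cmp (pos L c) pz
          ... | tri< c<z′ _ _ = c<z′
          ... | tri≈ _ c≡z _ with pos-injective L-bij c≡z
          ...   | refl = ⊥-elim (<-irrefl refl c<z)
          B₀-below-z⇒below-z c c<z | tri> _ _ z<c = ⊥-elim (<-asym c<z (B₀-mono z c (z≺beyond-z c z<c)))
          not-y : ∀ c → pos B₀ c ≢ b0y → pos L c ≢ py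
          not-y c c≢y c≡y with pos-injective L-bij c≡y
          ... | refl = c≢y refl
          below-n : ∀ {q} → q ∈ innerPositions b0x b0y b0z → q < n
          below-n q∈ = <-trans (proj₁ (proj₂ (∈-innerPositions⁻ b0x<b0y b0y<b0z q∈))) (toℕ<n (B₀ z))
          relocate : ∀ c → pos B₀ c ∈ innerPositions b0x b0y b0z → pos L c ∈ innerPositions px py pz
          relocate c c∈ with ∈-innerPositions⁻ b0x<b0y b0y<b0z c∈
          ... | x<c , c<z , c≢y = ∈-innerPositions⁺ (B₀-above-x⇒above-x c x<c) (B₀-below-z⇒below-z c c<z) (not-y c c≢y)

    encode-stuck-before : (∀ e → pos L e < px → ¬ FreeUp L px e) → Encoded
    encode-stuck-before before-stuck
      with FinP.any? (λ e → (pz <? pos L e) ×-dec FreeDown? L pz e ×-dec FinP.any? (Sinkable? e))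
    ... | yes (e , z<e , e-free , j , j-sinkable) = SunkToZ.absorb-right e z<e e-free j j-sinkable
    ... | no none with FinP.any? (λ e → (pz <? pos L e) ×-dec FreeDown? L pz e)
    ...   | yes (e , z<e , e-free) =
      ⊥-elim (sinking-impossible before-stuck (λ e z<e e-free j sinkable → none (e , z<e , e-free , j , sinkable)) e z<e e-free)
    ...   | no none′ = ⊥-elim (stuck-impossible before-stuck (λ e z<e e-free → none′ (e , z<e , e-free)))

    encode : Encoded
    encode with FinP.any? (λ e → (pos L e <? px) ×-dec FreeUp? L px e)
    ... | yes (e , e<x , free) = absorb-left e e<x free
    ... | no none = encode-stuck-before (λ e e<x free → none (e , e<x , free))

  insertion : 0 < F P x y z (k + 1) (ℓ + 1) → F P x y z k (ℓ + 1) ≤ n * (ℓ + 1) * F P x y z (k + 1) (ℓ + 1)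
  insertion F>0 with B₀ , B₀-F ← filter-nonempty (FCond? P x y z (k + 1) (ℓ + 1)) (allFuns n n) F>0 =
    subst (λ c → F P x y z k (ℓ + 1) ≤ c * F P x y z (k + 1) (ℓ + 1)) #tags
      (count-by-decoding (FCond? P x y z k (ℓ + 1)) (FCond? P x y z (k + 1) (ℓ + 1)) FCond-resp-≗ tags decode decode-resp-≗
                         (λ L L-F → Encoding.encode B₀ B₀-F L L-F))
    where
    #tags : length tags ≡ n * (ℓ + 1)
    #tags = trans (length-cartesianProduct (upTo n) (upTo (ℓ + 1))) (cong₂ _*_ (length-upTo n) (length-upTo (ℓ + 1)))

-- Duality

dual : ∀ {n} → FinPoset n → FinPoset n
dual P = record
  { _≺_    = λ u v → v ≺ u
  ; ≺-dec  = λ u v → ≺-dec v u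
  ; irrefl = irrefl
  ; trans  = λ u≻v v≻w → FinPoset.trans P v≻w u≻v
  }
  where open FinPoset P using (_≺_; ≺-dec; irrefl)

abstract
  reflect : ℕ → ℕ → ℕ
  reflect n p = n ∸ suc p

  reflect-< : ∀ {n p} → p < n → reflect n p < n
  reflect-< {suc n} {p} _ = s≤s (m∸n≤m n p)

  reflect-involutive : ∀ {n p} → p < n → reflect n (reflect n p) ≡ p
  reflect-involutive {suc n} (s≤s p≤n) = m∸[m∸n]≡n p≤n

  reflect-anti-< : ∀ {n p q} → p < q → q < n → reflect n q < reflect n p
  reflect-anti-< {suc n} p<q (s≤s q≤n) = ∸-monoʳ-< p<q q≤n

  reflect-gap : ∀ {n p q b} → q ≡ p + b → q < n → reflect n p ≡ reflect n q + b
  reflect-gap {suc n} {p} {q} {b} refl (s≤s q≤n) = begin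
    n ∸ p               ≡⟨ m∸n+n≡m b≤n∸p ⟨
    n ∸ p ∸ b + b       ≡⟨ cong (_+ b) (∸-+-assoc n p b) ⟩
    n ∸ (p + b) + b     ∎
    where
    open ≡-Reasoning
    b≤n∸p : b ≤ n ∸ p
    b≤n∸p = subst (_≤ n ∸ p) (m+n∸m≡n p b) (∸-monoˡ-≤ p q≤n)

module _ {n : ℕ} (P : FinPoset n) (x y z : Fin n) (a b : ℕ) where
  open FinPoset P using (_≺_)

  F≤F-dual : F P x y z a b ≤ F (dual P) z y x b a
  F≤F-dual = subst (F P x y z a b ≤_) (+-identityʳ _)
    (count-by-decoding (FCond? P x y z a b) (FCond? (dual P) z y x b a) (Moves.FCond-resp-≗ (dual P))
      (tt ∷ []) (λ _ → reindex (reflect n)) (λ _ → reindex-resp-≗ (reflect n)) encode)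
    where
    reflect-bounded : Bounded (reflect n)
    reflect-bounded _ = reflect-<
    encode : ∀ L → FCond P x y z a b L →
             ∃ λ M → FCond (dual P) z y x b a M × Any (λ _ → L ≗ reindex (reflect n) M) (tt ∷ [])
    encode L ((L-bij , L-mono) , y-gap , z-gap) = M , ((M-bij , M-mono) , M-y-gap , M-x-gap) , here L≗
      where
      M : Fin n → Fin n
      M = reindex (reflect n) L
      pos-M : ∀ u → pos M u ≡ reflect n (pos L u)
      pos-M = pos-reindex reflect-bounded L
      M-bij : IsBijection M
      M-bij = reindex-bijection reflect-bounded reflect-bounded (λ _ → reflect-involutive) (λ _ → reflect-involutive) L-bij
      M-mono : ∀ u v → v ≺ u → pos M u < pos M v
      M-mono u v v≺u = subst₂ _<_ (sym (pos-M u)) (sym (pos-M v)) (reflect-anti-< (L-mono v u v≺u) (toℕ<n (L u)))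
      M-y-gap : pos M y ≡ pos M z + b
      M-y-gap = trans (pos-M y) (trans (reflect-gap z-gap (toℕ<n (L z))) (cong (_+ b) (sym (pos-M z))))
      M-x-gap : pos M x ≡ pos M y + a
      M-x-gap = trans (pos-M x) (trans (reflect-gap y-gap (toℕ<n (L y))) (cong (_+ a) (sym (pos-M y))))
      L≗ : L ≗ reindex (reflect n) M
      L≗ = ≗-reindex (reflect n) M L (λ u → trans (cong (reflect n) (pos-M u)) (reflect-involutive (toℕ<n (L u))))

F-dual : ∀ {n} (P : FinPoset n) (x y z : Fin n) (a b : ℕ) → F (dual P) z y x b a ≡ F P x y z a b
F-dual P x y z a b = ≤-antisym (F≤F-dual (dual P) z y x b a) (F≤F-dual P x y z a b)

positive-*ˡ : ∀ m {n} → 0 < m * n → 0 < m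
positive-*ˡ m m*n>0 = >-nonZero⁻¹ m {{m*n≢0⇒m≢0 m {{>-nonZero m*n>0}}}}

positive-*ʳ : ∀ m {n} → 0 < m * n → 0 < n
positive-*ʳ m {n} m*n>0 = >-nonZero⁻¹ n {{m*n≢0⇒n≢0 m {{>-nonZero m*n>0}}}}

removal-dual : ∀ {n} (P : FinPoset n) (x y z : Fin n) (k ℓ : ℕ) → 1 ≤ k → 1 ≤ ℓ →
  0 < F P x y z k ℓ → F P x y z k (ℓ + 1) ≤ 2 * k * ℓ * F P x y z k ℓ
removal-dual P x y z k ℓ 1≤k 1≤ℓ A>0 = begin
  F P x y z k (ℓ + 1)               ≡⟨ F-dual P x y z k (ℓ + 1) ⟨
  F (dual P) z y x (ℓ + 1) k        ≤⟨ Removal.removal (dual P) z y x ℓ k 1≤ℓ 1≤k (subst (0 <_) (sym (F-dual P x y z k ℓ)) A>0) ⟩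
  2 * ℓ * k * F (dual P) z y x ℓ k  ≡⟨ cong₂ _*_ (trans (*-assoc 2 ℓ k) (trans (cong (2 *_) (*-comm ℓ k)) (sym (*-assoc 2 k ℓ))))
                                                 (F-dual P x y z k ℓ) ⟩
  2 * k * ℓ * F P x y z k ℓ         ∎
  where open ≤-Reasoning

insertion-dual : ∀ {n} (P : FinPoset n) (x y z : Fin n) (k ℓ : ℕ) → 1 ≤ ℓ →
  0 < F P x y z (k + 1) (ℓ + 1) → F P x y z (k + 1) ℓ ≤ n * (k + 1) * F P x y z (k + 1) (ℓ + 1)
insertion-dual {n} P x y z k ℓ 1≤ℓ B>0 = begin
  F P x y z (k + 1) ℓ                           ≡⟨ F-dual P x y z (k + 1) ℓ ⟨
  F (dual P) z y x ℓ (k + 1)                    ≤⟨ Insertion.insertion (dual P) z y x ℓ k 1≤ℓ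
                                                     (subst (0 <_) (sym (F-dual P x y z (k + 1) (ℓ + 1))) B>0) ⟩
  n * (k + 1) * F (dual P) z y x (ℓ + 1) (k + 1) ≡⟨ cong (n * (k + 1) *_) (F-dual P x y z (k + 1) (ℓ + 1)) ⟩
  n * (k + 1) * F P x y z (k + 1) (ℓ + 1)       ∎
  where open ≤-Reasoning

product-≤ : ∀ k ℓ m n A B {C D} → C ≤ 2 * k * ℓ * A → D ≤ n * (m + 1) * B →
            C * D ≤ 2 * k * ℓ * (m + 1) * n * (A * B)
product-≤ k ℓ m n A B C≤ D≤ = ≤-trans (*-mono-≤ C≤ D≤) (≤-reflexive
  (solve 6 (λ k ℓ m n A B → (con 2 :* k :* ℓ :* A) :* (n :* (m :+ con 1) :* B)
                          := con 2 :* k :* ℓ :* (m :+ con 1) :* n :* (A :* B)) refl k ℓ m n A B))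
  where open +-*-Solver

module _ {n : ℕ} (P : FinPoset n) (x y z : Fin n) (k ℓ : ℕ) (1≤k : 1 ≤ k) (1≤ℓ : 1 ≤ ℓ) where

  private
    A B C D : ℕ
    A = F P x y z k ℓ
    B = F P x y z (k + 1) (ℓ + 1)
    C = F P x y z (k + 1) ℓ
    D = F P x y z k (ℓ + 1)

  product-bound-with-ℓ : 0 < A * B → C * D ≤ 2 * k * ℓ * (ℓ + 1) * n * (A * B)
  product-bound-with-ℓ AB>0 =
    product-≤ k ℓ ℓ n A B (Removal.removal P x y z k ℓ 1≤k 1≤ℓ (positive-*ˡ A AB>0))
                          (Insertion.insertion P x y z k ℓ 1≤k (positive-*ʳ A AB>0))

  product-bound-with-k : 0 < A * B → C * D ≤ 2 * k * ℓ * (k + 1) * n * (A * B)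
  product-bound-with-k AB>0 = ≤-trans (≤-reflexive (*-comm C D))
    (product-≤ k ℓ k n A B (removal-dual P x y z k ℓ 1≤k 1≤ℓ (positive-*ˡ A AB>0))
                           (insertion-dual P x y z k ℓ 1≤ℓ (positive-*ʳ A AB>0)))

theorem1p4 : ∀ {n} (P : FinPoset n) (x y z : Fin n) →
    x ≢ y → y ≢ z → x ≢ z →
    (k ℓ : ℕ) → 1 ≤ k → 1 ≤ ℓ →
    0 < F P x y z k ℓ * F P x y z (k + 1) (ℓ + 1) →
    F P x y z (k + 1) ℓ * F P x y z k (ℓ + 1)
      ≤ 2 * k * ℓ * ((k ⊓ ℓ) + 1) * n * (F P x y z k ℓ * F P x y z (k + 1) (ℓ + 1))
theorem1p4 P x y z _ _ _ k ℓ 1≤k 1≤ℓ AB>0 with ≤-total k ℓ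
... | inj₁ k≤ℓ rewrite m≤n⇒m⊓n≡m k≤ℓ = product-bound-with-k P x y z k ℓ 1≤k 1≤ℓ AB>0
... | inj₂ ℓ≤k rewrite m≥n⇒m⊓n≡n ℓ≤k = product-bound-with-ℓ P x y z k ℓ 1≤k 1≤ℓ AB>0
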